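{- Let $G$ be a digraph, $l\geq 0$ an integer, and let $\mathcal{T}$ be a set of tangles in $G$, each of order $>l$, such that every two distinct tangles in $\mathcal{T}$ are $l$-distinguishable but not $(l-1)$-distinguishable. Then there is a tree-labelling $(L,\beta,\gamma)$ of $\mathcal{T}$ such that $|\gamma(e)|=l$ for all $e\in E(L)$. Here a tree-labelling of $\mathcal{T}$ is a triple $(L,\beta,\gamma)$ where $L$ is a tree, $\beta:V(L)\to\mathcal{T}$ and $\gamma:E(L)\to\mathcal{S}(G)$ are functions such that (1) $\beta$ is a bijection between $V(L)$ and $\mathcal{T}$; (2) if $t\neq t'\in V(L)$ and $P$ is the path in $L$ between $t$ and $t'$, then for every $e\in E(P)$ with $|\gamma(e)|=\min\{|\gamma(e')|:e'\in E(P)\}$, $\gamma(e)$ is a minimum order distinguisher between $\beta(t)$ and $\beta(t')$; (3) for every $e=\{s,s'\}\in E(L)$ there are $t$ in the component of $L-e$ containing $s$ and $t'$ in the component of $L-e$ containing $s'$ such that $\gamma(e)$ is a minimum order distinguisher of $\beta(t)$ and $\beta(t')$.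
   Context: All graphs are finite digraphs. A directed separation of $G$ is a pair $(A,B)$ of subgraphs of $G$ with $V(A)\cup V(B)=V(G)$ such that either no edge has tail in $V(A)\setminus V(B)$ and head in $V(B)\setminus V(A)$, or no edge has tail in $V(B)\setminus V(A)$ and head in $V(A)\setminus V(B)$; its order $|(A,B)|$ is $|V(A)\cap V(B)|$; $\mathcal{S}(G)$ is the set of all directed separations of $G$. A tangle of order $k$ in $G$ is a set $\mathcal{T}$ of directed separations of order $<k$ such that (i) for every directed separation $(A,B)$ of order $<k$, $(A,B)\in\mathcal{T}$ or $(B,A)\in\mathcal{T}$, and (ii) for all $(A_1,B_1),(A_2,B_2),(A_3,B_3)\in\mathcal{T}$, $V(A_1)\cup V(A_2)\cup V(A_3)\neq V(G)$. A separation $(A,B)$ distinguishes tangles $T,T'$ if one of them contains $(A,B)$ and the other contains $(B,A)$; $T,T'$ are $j$-distinguishable if some separation of order $j$ distinguishes them. A minimum order distinguisher of $T,T'$ is a distinguisher of smallest possible order. -}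

module Defs where

open import Data.Nat using (ℕ; _≤_; _<_; suc)
open import Data.Fin using (Fin)
open import Data.Fin.Subset using (Subset; _∈_; _∉_; _∩_; _∪_; ⊤; ∣_∣)
open import Data.Product using (Σ; _×_; _,_; ∃; ∃-syntax; proj₁; proj₂; swap)
open import Data.Sum using (_⊎_)
open import Data.List using (List; []; _∷_; length)
open import Data.List.Membership.Propositional using () renaming (_∈_ to _∈ₗ_; _∉_ to _∉ₗ_)
open import Data.List.Relation.Unary.Unique.Propositional using (Unique)
open import Relation.Nullary using (¬_)
open import Relation.Binary.PropositionalEquality using (_≡_; _≢_)
open import Function.Definitions using (Bijective)

-- Finite digraphs (vertices Fin n, edges Fin m; loops / parallel edges allowed)

record Digraph : Set where
  field
    n m  : ℕ
    tail : Fin m → Fin n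
    head : Fin m → Fin n

open Digraph

record Subgraph (G : Digraph) : Set where
  constructor subgraph
  field
    V : Subset (n G)
    E : Subset (m G)

open Subgraph

IsSubgraph : (G : Digraph) → Subgraph G → Set
IsSubgraph G A = ∀ e → e ∈ E A → (tail G e ∈ V A) × (head G e ∈ V A)

Pair : Digraph → Set
Pair G = Subgraph G × Subgraph G

NoEdgeFromTo : (G : Digraph) → Subgraph G → Subgraph G → Set
NoEdgeFromTo G A B = ∀ e →
  ¬ ((tail G e ∈ V A) × (tail G e ∉ V B) × (head G e ∈ V B) × (head G e ∉ V A))

IsDirSep : (G : Digraph) → Pair G → Set
IsDirSep G (A , B) =
  IsSubgraph G A × IsSubgraph G B × (V A ∪ V B ≡ ⊤) ×
  (NoEdgeFromTo G A B ⊎ NoEdgeFromTo G B A)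

order : {G : Digraph} → Pair G → ℕ
order (A , B) = ∣ V A ∩ V B ∣

SepSet : Digraph → Set₁
SepSet G = Pair G → Set

IsTangle : (G : Digraph) → ℕ → SepSet G → Set
IsTangle G k T =
  (∀ s → T s → IsDirSep G s × order s < k) ×
  (∀ s → IsDirSep G s → order s < k → T s ⊎ T (swap s)) ×
  (∀ A₁ B₁ A₂ B₂ A₃ B₃ → T (A₁ , B₁) → T (A₂ , B₂) → T (A₃ , B₃) →
     V A₁ ∪ V A₂ ∪ V A₃ ≢ ⊤)

Distinguishes : {G : Digraph} → SepSet G → SepSet G → Pair G → Set
Distinguishes T T' s = (T s × T' (swap s)) ⊎ (T (swap s) × T' s)

Distinguishable : (G : Digraph) → ℕ → SepSet G → SepSet G → Set
Distinguishable G j T T' =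
  ∃[ s ] IsDirSep G s × order s ≡ j × Distinguishes T T' s

MinDistinguisher : (G : Digraph) → SepSet G → SepSet G → Pair G → Set
MinDistinguisher G T T' s =
  IsDirSep G s × Distinguishes T T' s ×
  (∀ s' → IsDirSep G s' → Distinguishes T T' s' → order s ≤ order s')

record Graph : Set where
  field
    p q  : ℕ
    ends : Fin q → Fin p × Fin p

open Graph

Joins : (L : Graph) → Fin (q L) → Fin (p L) → Fin (p L) → Set
Joins L e u v = (ends L e ≡ (u , v)) ⊎ (ends L e ≡ (v , u))

data Walk (L : Graph) : Fin (p L) → Fin (p L) → List (Fin (q L)) → List (Fin (p L)) → Set where
  here : ∀ v → Walk L v v [] (v ∷ [])
  step : ∀ {u v w es vs} e → Joins L e u v → Walk L v w es vs → Walk L u w (e ∷ es) (u ∷ vs)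

Path : (L : Graph) → Fin (p L) → Fin (p L) → List (Fin (q L)) → Set
Path L u w es = ∃[ vs ] Walk L u w es vs × Unique vs

Simple : Graph → Set
Simple L =
  (∀ e → proj₁ (ends L e) ≢ proj₂ (ends L e)) ×
  (∀ e e' → e ≢ e' → ¬ Joins L e' (proj₁ (ends L e)) (proj₂ (ends L e)))

Connected : Graph → Set
Connected L = ∀ u v → ∃[ es ] Path L u v es

HasCycle : Graph → Set
HasCycle L = ∃[ e ] ∃[ u ] ∃[ v ] ∃[ es ]
  Joins L e u v × Path L v u es × e ∉ₗ es × 2 ≤ length es

IsTree : Graph → Set
IsTree L = Simple L × Connected L × ¬ HasCycle L

InComponentMinus : (L : Graph) → Fin (q L) → Fin (p L) → Fin (p L) → Set
InComponentMinus L e s t = ∃[ es ] Path L s t es × e ∉ₗ es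

IsTreeLabelling : (G : Digraph) (N : ℕ) (𝒯 : Fin N → SepSet G)
  (L : Graph) → (Fin (p L) → Fin N) → (Fin (q L) → Pair G) → Set
IsTreeLabelling G N 𝒯 L β γ =
  IsTree L ×
  (∀ e → IsDirSep G (γ e)) ×
  Bijective _≡_ _≡_ β ×
  (∀ t t' → t ≢ t' → ∀ es → Path L t t' es → ∀ e → e ∈ₗ es →
     (∀ e' → e' ∈ₗ es → order (γ e) ≤ order (γ e')) →
     MinDistinguisher G (𝒯 (β t)) (𝒯 (β t')) (γ e)) ×
  (∀ e → ∃[ t ] ∃[ t' ]
     InComponentMinus L e (proj₁ (ends L e)) t ×
     InComponentMinus L e (proj₂ (ends L e)) t' ×
     MinDistinguisher G (𝒯 (β t)) (𝒯 (β t')) (γ e))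

-- Fix a root tangle r. Call a set S of tangles an 𝓢-set if, for some separation of order l,
-- the tangles in S orient it one way and all other tangles the other way. No separation of
-- order < l distinguishes two of the tangles, so by submodularity the corners of two crossing
-- such separations have order l again: 𝓢-sets avoiding r are closed under uncrossing (∩ and ∪,
-- or the two differences). A greedy recursion (take a largest 𝓢-set M, pick m ∈ M for which the
-- 𝓢-sets inside M avoiding m cover the most, recurse on M ∖ {m} and on the rest) yields for
-- every tangle x ≠ r an 𝓢-set D x ∋ x, any two of which are nested or disjoint. These are the
-- subtrees of a tree on the tangles rooted at r; labelling the edge above x with the separation
-- defining D x gives a tree-labelling whose labels all have order l, and each is a minimum order
-- distinguisher because every distinguisher of two of the tangles has order at least l.

module Submission where

open import Defs
open import Data.Nat using (ℕ; _<_; suc)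
open import Data.Fin using (Fin)
open import Data.Product using (Σ; _×_; ∃-syntax)
open import Relation.Nullary using (¬_)
open import Relation.Binary.PropositionalEquality using (_≡_; _≢_)
open import Data.Nat using (zero; _+_; _∸_; _≤_; z≤n; s≤s; _<?_; _≤?_; _≤ᵇ_) renaming (_≟_ to _≟ℕ_)
open import Data.Nat.Properties hiding (suc-injective)
open import Data.Bool using (Bool; true; false; not; _∧_; _∨_; if_then_else_)
import Data.Bool.Properties as 𝔹
open import Data.Fin using (zero; suc)
open import Data.Fin.Properties using (any?; all?; suc-injective) renaming (_≟_ to _≟ᶠ_)
open import Data.Fin.Subset.Properties using (anySubset?)
open import Data.Vec using (lookup; tabulate; []; _∷_)
open import Data.Vec.Properties using (≡-dec; lookup∘tabulate; lookup-zipWith; []=⇒lookup; lookup⇒[]=; lookup-replicate)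
open import Data.Fin.Subset using (Subset; _∈_; _∉_; _∩_; _∪_; ⊤; ∣_∣; ⁅_⁆) renaming (⊥ to ∅)
open import Data.Fin.Subset.Properties using (_∈?_; ∉⊥; x∈⁅x⁆; x≢y⇒x∉⁅y⁆; x∈⁅y⁆⇒x≡y; ∩-comm; x∈p∪q⁺; x∈p∪q⁻; x∈p∩q⁺; x∈p∩q⁻)
open import Data.Product using (_,_; ∃; proj₁; proj₂; swap)
open import Data.Sum using (_⊎_; inj₁; inj₂; [_,_]′)
open import Data.Empty using (⊥; ⊥-elim)
open import Relation.Nullary using (Dec; yes; no; does)
open import Relation.Nullary.Decidable using (_×-dec_; _⊎-dec_; ¬?; map′; dec-true)
open import Relation.Binary.PropositionalEquality using (refl; sym; trans; cong; cong₂; subst; subst₂; _≗_; module ≡-Reasoning)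
open import Function using (_∘_; id)
open import Function.Bundles using (Equivalence)
open import Algebra.Properties.CommutativeSemigroup +-commutativeSemigroup using (interchange)
open import Data.List using ([]; _∷_; _++_)
open import Data.List.Relation.Unary.Any as Any using (Any)
open import Data.List.Relation.Unary.All as All using (All; []; _∷_)
open import Data.List.Relation.Unary.All.Properties using (¬Any⇒All¬)
open import Data.List.Relation.Unary.AllPairs using ([]; _∷_)
open import Data.List.Membership.Propositional using () renaming (_∈_ to _∈ₗ_; _∉_ to _∉ₗ_)
open import Data.List.Relation.Unary.Unique.Propositional using (Unique)

≡true⇒≢false : ∀ {a} → a ≡ true → a ≢ false
≡true⇒≢false refl ()

≢true⇒≡false : ∀ {a} → a ≢ true → a ≡ false
≢true⇒≡false {false} _ = refl
≢true⇒≡false {true} h = ⊥-elim (h refl)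

≢false⇒≡true : ∀ {a} → a ≢ false → a ≡ true
≢false⇒≡true {true} _ = refl
≢false⇒≡true {false} h = ⊥-elim (h refl)

true-or-false : ∀ a → a ≡ true ⊎ a ≡ false
true-or-false true = inj₁ refl
true-or-false false = inj₂ refl

≢⇒one-true : ∀ {a b} → a ≢ b → a ≡ true ⊎ b ≡ true
≢⇒one-true {true} _ = inj₁ refl
≢⇒one-true {false} {true} _ = inj₂ refl
≢⇒one-true {false} {false} ne = ⊥-elim (ne refl)

≢∧true⇒false : ∀ {a b} → a ≢ b → a ≡ true → b ≡ false
≢∧true⇒false ne refl = ≢true⇒≡false (ne ∘ sym)

≢∧false⇒true : ∀ {a b} → a ≢ b → a ≡ false → b ≡ true
≢∧false⇒true ne refl = ≢false⇒≡true (ne ∘ sym)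

∧≡true⇒ˡ : ∀ {a b} → a ∧ b ≡ true → a ≡ true
∧≡true⇒ˡ {true} _ = refl

∧≡true⇒ʳ : ∀ {a b} → a ∧ b ≡ true → b ≡ true
∧≡true⇒ʳ {true} h = h

∧≡true⁺ : ∀ {a b} → a ≡ true → b ≡ true → a ∧ b ≡ true
∧≡true⁺ refl refl = refl

∧≡false⁻ : ∀ {a b} → a ∧ b ≡ false → a ≡ false ⊎ b ≡ false
∧≡false⁻ {false} _ = inj₁ refl
∧≡false⁻ {true} h = inj₂ h

∧≡false⇒ʳ : ∀ {a b} → a ∧ b ≡ false → a ≡ true → b ≡ false
∧≡false⇒ʳ h refl = h

∧≡false⇒ˡ : ∀ {a b} → a ∧ b ≡ false → b ≡ true → a ≡ false
∧≡false⇒ˡ {a} h refl = trans (sym (𝔹.∧-identityʳ a)) h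

∨≡true⁺ˡ : ∀ {a b} → a ≡ true → a ∨ b ≡ true
∨≡true⁺ˡ refl = refl

∨≡true⁺ʳ : ∀ {a b} → b ≡ true → a ∨ b ≡ true
∨≡true⁺ʳ {true} _ = refl
∨≡true⁺ʳ {false} h = h

∨≡true⁻ : ∀ {a b} → a ∨ b ≡ true → a ≡ true ⊎ b ≡ true
∨≡true⁻ {true} _ = inj₁ refl
∨≡true⁻ {false} h = inj₂ h

∨≡false⁻ : ∀ {a b} → a ∨ b ≡ false → a ≡ false × b ≡ false
∨≡false⁻ {false} h = refl , h

not≡true⇒ : ∀ {a} → not a ≡ true → a ≡ false
not≡true⇒ {false} _ = refl

not≡false⇒ : ∀ {a} → not a ≡ false → a ≡ true
not≡false⇒ {true} _ = refl

≡false⇒not≡true : ∀ {a} → a ≡ false → not a ≡ true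
≡false⇒not≡true refl = refl

∧-cancelʳ-true : ∀ {a b c d} → c ≡ true → d ≡ true → a ∧ c ≡ b ∧ d → a ≡ b
∧-cancelʳ-true {a} {b} refl refl eq = trans (sym (𝔹.∧-identityʳ a)) (trans eq (𝔹.∧-identityʳ b))

∧-not-cancel-true : ∀ {a b c d} → c ≡ true → d ≡ true → c ∧ not a ≡ d ∧ not b → a ≡ b
∧-not-cancel-true refl refl = 𝔹.not-injective

allᵇ : (Bool → Bool) → Bool
allᵇ f = f true ∧ f false

allᵇ-sound : ∀ f → allᵇ f ≡ true → ∀ b → f b ≡ true
allᵇ-sound _ h true = ∧≡true⇒ˡ h
allᵇ-sound _ h false = ∧≡true⇒ʳ h

allᵇ-sound₄ : ∀ (f : Bool → Bool → Bool → Bool → Bool) → (allᵇ λ a → allᵇ λ b → allᵇ λ c → allᵇ (f a b c)) ≡ true → ∀ a b c d → f a b c d ≡ true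
allᵇ-sound₄ f h a b c d =
  allᵇ-sound (f a b c) (allᵇ-sound (λ c → allᵇ (f a b c))
    (allᵇ-sound (λ b → allᵇ λ c → allᵇ (f a b c)) (allᵇ-sound (λ a → allᵇ λ b → allᵇ λ c → allᵇ (f a b c)) h a) b) c) d

CoveredImplies : (Bool → Bool → Bool → Bool → Bool) → Bool → Bool → Bool → Bool → Bool
CoveredImplies φ a b c d = not ((a ∨ b) ∧ (c ∨ d)) ∨ φ a b c d

CoveredTautology : (Bool → Bool → Bool → Bool → Bool) → Bool
CoveredTautology φ = allᵇ λ a → allᵇ λ b → allᵇ λ c → allᵇ (CoveredImplies φ a b c)

coveredTautology : ∀ φ → CoveredTautology φ ≡ true →
  ∀ a b c d → a ∨ b ≡ true → c ∨ d ≡ true → φ a b c d ≡ true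
coveredTautology φ h a b c d ab cd =
  subst₂ (λ x y → not (x ∧ y) ∨ φ a b c d ≡ true) ab cd (allᵇ-sound₄ (CoveredImplies φ) h a b c d)

BoolSet : ℕ → Set
BoolSet N = Fin N → Bool

infixr 7 _∩ᵇ_
infixr 6 _∪ᵇ_ _∖ᵇ_
infix 4 _⊆ᵇ_ _⊈ᵇ_

_∩ᵇ_ _∪ᵇ_ _∖ᵇ_ : ∀ {N} → BoolSet N → BoolSet N → BoolSet N
(S ∩ᵇ T) x = S x ∧ T x
(S ∪ᵇ T) x = S x ∨ T x
(S ∖ᵇ T) x = S x ∧ not (T x)

_⊆ᵇ_ _⊈ᵇ_ Meets : ∀ {N} → BoolSet N → BoolSet N → Set
S ⊆ᵇ T = ∀ x → S x ≡ true → T x ≡ true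
S ⊈ᵇ T = ∃ λ x → S x ≡ true × T x ≡ false
Meets S T = ∃ λ x → S x ≡ true × T x ≡ true

⊆ᵇ-trans : ∀ {N} {S T U : BoolSet N} → S ⊆ᵇ T → T ⊆ᵇ U → S ⊆ᵇ U
⊆ᵇ-trans S⊆T T⊆U x = T⊆U x ∘ S⊆T x

⊆ᵇ-respects-false : ∀ {N} {S T : BoolSet N} {x} → S ⊆ᵇ T → T x ≡ false → S x ≡ false
⊆ᵇ-respects-false S⊆T Tx = ≢true⇒≡false λ Sx → ≡true⇒≢false (S⊆T _ Sx) Tx

_⊆ᵇ?_ : ∀ {N} (S T : BoolSet N) → Dec (S ⊆ᵇ T)
S ⊆ᵇ? T = all? λ x → implies? (S x) (T x)
  where
  implies? : (a b : Bool) → Dec (a ≡ true → b ≡ true)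
  implies? false _ = yes λ ()
  implies? true true = yes λ _ → refl
  implies? true false = no λ f → ≡true⇒≢false (f refl) refl

⊆ᵇ-or-⊈ᵇ : ∀ {N} (S T : BoolSet N) → S ⊆ᵇ T ⊎ S ⊈ᵇ T
⊆ᵇ-or-⊈ᵇ S T with any? (λ x → (S x 𝔹.≟ true) ×-dec (T x 𝔹.≟ false))
... | yes w = inj₂ w
... | no ¬w = inj₁ λ x Sx → ≢false⇒≡true λ Tx → ¬w (x , Sx , Tx)

disjoint-or-meets : ∀ {N} (S T : BoolSet N) →
  (∀ x → S x ≡ true → T x ≡ false) ⊎ Meets S T
disjoint-or-meets S T with any? (λ x → (S x 𝔹.≟ true) ×-dec (T x 𝔹.≟ true))
... | yes w = inj₂ w
... | no ¬w = inj₁ λ x Sx → ≢true⇒≡false λ Tx → ¬w (x , Sx , Tx)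

∃BoolSet? : ∀ {N} (P : BoolSet N → Set) → (∀ {S T} → S ≗ T → P S → P T) →
            (∀ S → Dec (P S)) → Dec (∃ P)
∃BoolSet? P resp P? with anySubset? (P? ∘ lookup)
... | yes (V , p) = yes (lookup V , p)
... | no ¬p = no λ (S , PS) → ¬p (tabulate S , resp (sym ∘ lookup∘tabulate S) PS)

count : Bool → ℕ
count true = 1
count false = 0

size : ∀ {N} → BoolSet N → ℕ
size {zero} S = 0
size {suc N} S = count (S zero) + size (S ∘ suc)

size≤ : ∀ {N} (S : BoolSet N) → size S ≤ N
size≤ {zero} S = z≤n
size≤ {suc N} S with S zero
... | true = s≤s (size≤ (S ∘ suc))
... | false = m≤n⇒m≤1+n (size≤ (S ∘ suc))

size-cong : ∀ {N} {S T : BoolSet N} → S ≗ T → size S ≡ size T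
size-cong {zero} _ = refl
size-cong {suc N} S≗T = cong₂ _+_ (cong count (S≗T zero)) (size-cong (S≗T ∘ suc))

⊆ᵇ⇒size≤ : ∀ {N} {S T : BoolSet N} → S ⊆ᵇ T → size S ≤ size T
⊆ᵇ⇒size≤ {zero} _ = z≤n
⊆ᵇ⇒size≤ {suc N} {S} {T} S⊆T with S zero in eS | T zero in eT
... | true | true = s≤s (⊆ᵇ⇒size≤ (S⊆T ∘ suc))
... | true | false = ⊥-elim (≡true⇒≢false (S⊆T zero eS) eT)
... | false | true = m≤n⇒m≤1+n (⊆ᵇ⇒size≤ (S⊆T ∘ suc))
... | false | false = ⊆ᵇ⇒size≤ (S⊆T ∘ suc)

⊂ᵇ⇒size< : ∀ {N} {S T : BoolSet N} → S ⊆ᵇ T → ∀ x → T x ≡ true → S x ≡ false → size S < size T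
⊂ᵇ⇒size< {suc N} {S} {T} S⊆T zero Tx Sx rewrite Tx | Sx = s≤s (⊆ᵇ⇒size≤ (S⊆T ∘ suc))
⊂ᵇ⇒size< {suc N} {S} {T} S⊆T (suc x) Tx Sx with S zero in eS | T zero in eT
... | true | true = s≤s (⊂ᵇ⇒size< (S⊆T ∘ suc) x Tx Sx)
... | true | false = ⊥-elim (≡true⇒≢false (S⊆T zero eS) eT)
... | false | true = m≤n⇒m≤1+n (⊂ᵇ⇒size< (S⊆T ∘ suc) x Tx Sx)
... | false | false = ⊂ᵇ⇒size< (S⊆T ∘ suc) x Tx Sx

∈⇒size>0 : ∀ {N} {S : BoolSet N} x → S x ≡ true → 0 < size S
∈⇒size>0 {suc N} {S} zero Sx rewrite Sx = s≤s z≤n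
∈⇒size>0 {suc N} {S} (suc x) Sx = ≤-trans (∈⇒size>0 {S = S ∘ suc} x Sx) (m≤n+m _ (count (S zero)))

size>0⇒∈ : ∀ {N} (S : BoolSet N) → 0 < size S → ∃ λ x → S x ≡ true
size>0⇒∈ {suc N} S h with S zero in eS
... | true = zero , eS
... | false = let x , Sx = size>0⇒∈ (S ∘ suc) h in suc x , Sx

size-pointwise-≤ : ∀ {N} (S T U W : BoolSet N) →
  (∀ i → count (S i) + count (T i) ≤ count (U i) + count (W i)) → size S + size T ≤ size U + size W
size-pointwise-≤ {zero} _ _ _ _ _ = z≤n
size-pointwise-≤ {suc N} S T U W h =
  subst₂ _≤_ (interchange (count (S zero)) (count (T zero)) (size (S ∘ suc)) (size (T ∘ suc)))
             (interchange (count (U zero)) (count (W zero)) (size (U ∘ suc)) (size (W ∘ suc)))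
    (+-mono-≤ (h zero) (size-pointwise-≤ (S ∘ suc) (T ∘ suc) (U ∘ suc) (W ∘ suc) (h ∘ suc)))

size-insert : ∀ {N} (S T : BoolSet N) v → (∀ i → i ≢ v → S i ≡ T i) → S v ≡ false → T v ≡ true →
  size T ≡ suc (size S)
size-insert {suc N} S T zero same Sv Tv rewrite Sv | Tv =
  cong suc (sym (size-cong λ i → same (suc i) λ ()))
size-insert {suc N} S T (suc v) same Sv Tv rewrite same zero (λ ()) =
  trans (cong (count (T zero) +_) (size-insert (S ∘ suc) (T ∘ suc) v (λ i i≢v → same (suc i) (i≢v ∘ suc-injective)) Sv Tv))
        (+-suc (count (T zero)) _)

module Extremum {A : Set} (P : A → Set) (f : A → ℕ) where

  module _ (bound : ℕ) (bounded : ∀ a → P a → f a ≤ bound)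
           (larger? : ∀ n → Dec (∃ λ a → P a × n < f a)) where

    private
      climb : ∀ fuel a → P a → bound ∸ f a ≤ fuel → ∃ λ a* → P a* × (∀ a → P a → f a ≤ f a*)
      climb fuel a Pa _ with larger? (f a)
      ... | no ¬larger = a , Pa , λ b Pb → ≮⇒≥ λ lt → ¬larger (b , Pb , lt)
      climb zero a _ gap | yes (b , Pb , lt) =
        ⊥-elim (<-irrefl refl (<-≤-trans (∸-monoʳ-< lt (bounded b Pb)) (≤-trans gap z≤n)))
      climb (suc fuel) a _ gap | yes (b , Pb , lt) =
        climb fuel b Pb (≤-pred (≤-trans (∸-monoʳ-< lt (bounded b Pb)) gap))

    maximum : ∀ a → P a → ∃ λ a* → P a* × (∀ a → P a → f a ≤ f a*)
    maximum a Pa = climb bound a Pa (m∸n≤m bound (f a))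

  module _ (smaller? : ∀ n → Dec (∃ λ a → P a × f a < n)) where

    private
      descend : ∀ fuel a → P a → f a ≤ fuel → ∃ λ a* → P a* × (∀ a → P a → f a* ≤ f a)
      descend fuel a Pa _ with smaller? (f a)
      ... | no ¬smaller = a , Pa , λ b Pb → ≮⇒≥ λ lt → ¬smaller (b , Pb , lt)
      descend zero a _ gap | yes (b , Pb , lt) = ⊥-elim (<-irrefl refl (<-≤-trans lt (≤-trans gap z≤n)))
      descend (suc fuel) a _ gap | yes (b , Pb , lt) = descend fuel b Pb (≤-pred (<-≤-trans lt gap))

    minimum : ∀ a → P a → ∃ λ a* → P a* × (∀ a → P a → f a* ≤ f a)
    minimum a Pa = descend (f a) a Pa ≤-refl

does≡true⇒ : ∀ {A : Set} (a? : Dec A) → does a? ≡ true → A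
does≡true⇒ (yes a) _ = a

does≡false⇒ : ∀ {A : Set} (a? : Dec A) → does a? ≡ false → ¬ A
does≡false⇒ (no ¬a) _ = ¬a

×-dec-given : ∀ {A B : Set} → Dec A → (A → Dec B) → Dec (A × B)
×-dec-given (yes a) B? = map′ (a ,_) proj₂ (B? a)
×-dec-given (no ¬a) _ = no (¬a ∘ proj₁)

-- Nested families from uncrossable set systems

module Laminar {N : ℕ} (r : Fin N) (𝓧 𝓨 : BoolSet N → Set)
  (𝓧-resp : ∀ {S T} → S ≗ T → 𝓧 S → 𝓧 T)
  (𝓨-resp : ∀ {S T} → S ≗ T → 𝓨 S → 𝓨 T)
  (𝓧? : ∀ S → Dec (𝓧 S)) (𝓨? : ∀ S → Dec (𝓨 S))
  (𝓧-uncross : ∀ A B → 𝓧 A → 𝓧 B → A r ≡ false → B r ≡ false →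
     Meets A B → 𝓧 (A ∩ᵇ B) × 𝓧 (A ∪ᵇ B))
  (𝓨-uncross : ∀ A B → 𝓨 A → 𝓨 B → A r ≡ false → B r ≡ false →
     Meets A B → 𝓨 (A ∩ᵇ B) × 𝓨 (A ∪ᵇ B))
  (𝓧𝓨-uncross : ∀ A B → 𝓧 A → 𝓨 B → A ⊈ᵇ B →
     B ⊈ᵇ A → 𝓧 (A ∖ᵇ B) × 𝓨 (B ∖ᵇ A))
  where

  𝓢 : BoolSet N → Set
  𝓢 S = 𝓧 S ⊎ 𝓨 S

  𝓢-resp : ∀ {S T} → S ≗ T → 𝓢 S → 𝓢 T
  𝓢-resp S≗T = [ inj₁ ∘ 𝓧-resp S≗T , inj₂ ∘ 𝓨-resp S≗T ]′

  𝓢? : ∀ S → Dec (𝓢 S)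
  𝓢? S = 𝓧? S ⊎-dec 𝓨? S

  𝓢-uncross : ∀ A B → 𝓢 A → 𝓢 B → A r ≡ false → B r ≡ false →
    (Meets A B → 𝓢 (A ∩ᵇ B) × 𝓢 (A ∪ᵇ B)) ⊎ (A ⊈ᵇ B × B ⊈ᵇ A → 𝓢 (A ∖ᵇ B) × 𝓢 (B ∖ᵇ A))
  𝓢-uncross A B (inj₁ 𝓧A) (inj₁ 𝓧B) Ar Br = inj₁ λ meet →
    let A∩B , A∪B = 𝓧-uncross A B 𝓧A 𝓧B Ar Br meet in inj₁ A∩B , inj₁ A∪B
  𝓢-uncross A B (inj₂ 𝓨A) (inj₂ 𝓨B) Ar Br = inj₁ λ meet →
    let A∩B , A∪B = 𝓨-uncross A B 𝓨A 𝓨B Ar Br meet in inj₂ A∩B , inj₂ A∪B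
  𝓢-uncross A B (inj₁ 𝓧A) (inj₂ 𝓨B) _ _ = inj₂ λ (A⊄B , B⊄A) →
    let A∖B , B∖A = 𝓧𝓨-uncross A B 𝓧A 𝓨B A⊄B B⊄A in inj₁ A∖B , inj₂ B∖A
  𝓢-uncross A B (inj₂ 𝓨A) (inj₁ 𝓧B) _ _ = inj₂ λ (A⊄B , B⊄A) →
    let B∖A , A∖B = 𝓧𝓨-uncross B A 𝓧B 𝓨A B⊄A A⊄B in inj₂ A∖B , inj₁ B∖A

  Covered Separated : BoolSet N → Set
  Covered G = ∀ x → G x ≡ true → ∃ λ S → 𝓢 S × S ⊆ᵇ G × S x ≡ true
  Separated G = ∀ x y → G x ≡ true → G y ≡ true → x ≢ y → ∃ λ S → 𝓢 S × S ⊆ᵇ G × S x ≢ S y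

  record NestedFamily (G : BoolSet N) : Set where
    field
      D : Fin N → BoolSet N
      D-refl : ∀ x → G x ≡ true → D x x ≡ true
      D⊆G : ∀ x → G x ≡ true → D x ⊆ᵇ G
      D-𝓢 : ∀ x → G x ≡ true → 𝓢 (D x)
      D-nested : ∀ x u → G x ≡ true → G u ≡ true → D x u ≡ true → D u ⊆ᵇ D x
      D-comparable : ∀ u v z → G u ≡ true → G v ≡ true → D u z ≡ true → D v z ≡ true →
        D u v ≡ true ⊎ D v u ≡ true
      D-antisym : ∀ u v → G u ≡ true → G v ≡ true → D u v ≡ true → D v u ≡ true → u ≡ v

  nestedFamily-empty : ∀ G → (∀ x → G x ≡ false) → NestedFamily G
  nestedFamily-empty G G≡∅ = record
    { D = λ _ _ → false
    ; D-refl = λ x Gx → absurd Gx (G≡∅ x)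
    ; D⊆G = λ x Gx → absurd Gx (G≡∅ x)
    ; D-𝓢 = λ x Gx → absurd Gx (G≡∅ x)
    ; D-nested = λ x _ Gx → absurd Gx (G≡∅ x)
    ; D-comparable = λ u _ _ Gu → absurd Gu (G≡∅ u)
    ; D-antisym = λ u _ Gu → absurd Gu (G≡∅ u) }
    where
    absurd : ∀ {A : Set} {a} → a ≡ true → a ≡ false → A
    absurd t f = ⊥-elim (≡true⇒≢false t f)

  -- Here G₁ = M ∖ {m}, and D m = M glues nested families on G₁ and on G ∖ M into one on G.
  module Glue (G M G₁ : BoolSet N) (m : Fin N)
    (M-m : M m ≡ true) (M⊆G : M ⊆ᵇ G) (𝓢M : 𝓢 M)
    (G₁⊆M : G₁ ⊆ᵇ M) (G₁-m : G₁ m ≡ false)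
    (M-split : ∀ x → M x ≡ true → x ≢ m → G₁ x ≡ true)
    (F₁ : NestedFamily G₁) (F₂ : NestedFamily (G ∖ᵇ M)) where

    private
      module F₁ = NestedFamily F₁
      module F₂ = NestedFamily F₂

    G₂ : BoolSet N
    G₂ = G ∖ᵇ M

    G₂∌M : ∀ {z} → G₂ z ≡ true → M z ≡ false
    G₂∌M = not≡true⇒ ∘ ∧≡true⇒ʳ

    G₂∌G₁ : ∀ {z} → G₂ z ≡ true → G₁ z ≡ false
    G₂∌G₁ G₂z = ⊆ᵇ-respects-false G₁⊆M (G₂∌M G₂z)

    D : Fin N → BoolSet N
    D x with x ≟ᶠ m
    ... | yes _ = M
    ... | no _ = if G₁ x then F₁.D x else F₂.D x

    D-m : D m ≡ M
    D-m with m ≟ᶠ m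
    ... | yes _ = refl
    ... | no m≢m = ⊥-elim (m≢m refl)

    D-G₁ : ∀ {x} → G₁ x ≡ true → D x ≡ F₁.D x
    D-G₁ {x} G₁x with x ≟ᶠ m
    ... | yes refl = ⊥-elim (≡true⇒≢false G₁x G₁-m)
    ... | no _ rewrite G₁x = refl

    D-G₂ : ∀ {x} → G₂ x ≡ true → D x ≡ F₂.D x
    D-G₂ {x} G₂x with x ≟ᶠ m
    ... | yes refl = ⊥-elim (≡true⇒≢false M-m (G₂∌M G₂x))
    ... | no _ rewrite G₂∌G₁ G₂x = refl

    data Region (x : Fin N) : Set where
      at-m : x ≡ m → Region x
      in₁ : G₁ x ≡ true → Region x
      in₂ : G₂ x ≡ true → Region x

    region : ∀ x → G x ≡ true → Region x
    region x Gx with true-or-false (M x)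
    ... | inj₂ Mx = in₂ (∧≡true⁺ Gx (≡false⇒not≡true Mx))
    ... | inj₁ Mx with x ≟ᶠ m
    ...   | yes x≡m = at-m x≡m
    ...   | no x≢m = in₁ (M-split x Mx x≢m)

    D₁-closed : ∀ {x z} → G₁ x ≡ true → D x z ≡ true → G₁ z ≡ true
    D₁-closed {x} {z} G₁x Dxz = F₁.D⊆G x G₁x z (subst (λ T → T z ≡ true) (D-G₁ G₁x) Dxz)

    D₂-closed : ∀ {x z} → G₂ x ≡ true → D x z ≡ true → G₂ z ≡ true
    D₂-closed {x} {z} G₂x Dxz = F₂.D⊆G x G₂x z (subst (λ T → T z ≡ true) (D-G₂ G₂x) Dxz)

    Dm⊆M : ∀ {z} → D m z ≡ true → M z ≡ true
    Dm⊆M {z} = subst (λ T → T z ≡ true) D-m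

    D-refl : ∀ x → G x ≡ true → D x x ≡ true
    D-refl x Gx with region x Gx
    ... | at-m refl rewrite D-m = M-m
    ... | in₁ G₁x rewrite D-G₁ G₁x = F₁.D-refl x G₁x
    ... | in₂ G₂x rewrite D-G₂ G₂x = F₂.D-refl x G₂x

    D⊆G : ∀ x → G x ≡ true → D x ⊆ᵇ G
    D⊆G x Gx with region x Gx
    ... | at-m refl rewrite D-m = M⊆G
    ... | in₁ G₁x rewrite D-G₁ G₁x = ⊆ᵇ-trans (F₁.D⊆G x G₁x) (⊆ᵇ-trans G₁⊆M M⊆G)
    ... | in₂ G₂x rewrite D-G₂ G₂x = ⊆ᵇ-trans (F₂.D⊆G x G₂x) (λ _ → ∧≡true⇒ˡ)

    D-𝓢 : ∀ x → G x ≡ true → 𝓢 (D x)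
    D-𝓢 x Gx with region x Gx
    ... | at-m refl rewrite D-m = 𝓢M
    ... | in₁ G₁x rewrite D-G₁ G₁x = F₁.D-𝓢 x G₁x
    ... | in₂ G₂x rewrite D-G₂ G₂x = F₂.D-𝓢 x G₂x

    D-nested : ∀ x u → G x ≡ true → G u ≡ true → D x u ≡ true → D u ⊆ᵇ D x
    D-nested x u Gx Gu Dxu with region x Gx | region u Gu
    ... | at-m refl | at-m refl = λ _ → id
    ... | at-m refl | in₁ G₁u rewrite D-m | D-G₁ G₁u = ⊆ᵇ-trans (F₁.D⊆G u G₁u) G₁⊆M
    ... | at-m refl | in₂ G₂u = ⊥-elim (≡true⇒≢false (Dm⊆M Dxu) (G₂∌M G₂u))
    ... | in₁ G₁x | _ =
      let G₁u = D₁-closed G₁x Dxu in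
      subst₂ _⊆ᵇ_ (sym (D-G₁ G₁u)) (sym (D-G₁ G₁x))
        (F₁.D-nested x u G₁x G₁u (subst (λ T → T u ≡ true) (D-G₁ G₁x) Dxu))
    ... | in₂ G₂x | _ =
      let G₂u = D₂-closed G₂x Dxu in
      subst₂ _⊆ᵇ_ (sym (D-G₂ G₂u)) (sym (D-G₂ G₂x))
        (F₂.D-nested x u G₂x G₂u (subst (λ T → T u ≡ true) (D-G₂ G₂x) Dxu))

    D-comparable : ∀ u v z → G u ≡ true → G v ≡ true → D u z ≡ true → D v z ≡ true →
      D u v ≡ true ⊎ D v u ≡ true
    D-comparable u v z Gu Gv Duz Dvz with region u Gu | region v Gv
    ... | at-m refl | at-m refl = inj₁ (D-refl u Gu)
    ... | at-m refl | in₁ G₁v = inj₁ (subst (λ T → T v ≡ true) (sym D-m) (G₁⊆M v G₁v))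
    ... | in₁ G₁u | at-m refl = inj₂ (subst (λ T → T u ≡ true) (sym D-m) (G₁⊆M u G₁u))
    ... | at-m refl | in₂ G₂v = ⊥-elim (≡true⇒≢false (Dm⊆M Duz) (G₂∌M (D₂-closed G₂v Dvz)))
    ... | in₂ G₂u | at-m refl = ⊥-elim (≡true⇒≢false (Dm⊆M Dvz) (G₂∌M (D₂-closed G₂u Duz)))
    ... | in₁ G₁u | in₂ G₂v = ⊥-elim (≡true⇒≢false (D₁-closed G₁u Duz) (G₂∌G₁ (D₂-closed G₂v Dvz)))
    ... | in₂ G₂u | in₁ G₁v = ⊥-elim (≡true⇒≢false (D₁-closed G₁v Dvz) (G₂∌G₁ (D₂-closed G₂u Duz)))
    ... | in₁ G₁u | in₁ G₁v rewrite D-G₁ G₁u | D-G₁ G₁v = F₁.D-comparable u v z G₁u G₁v Duz Dvz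
    ... | in₂ G₂u | in₂ G₂v rewrite D-G₂ G₂u | D-G₂ G₂v = F₂.D-comparable u v z G₂u G₂v Duz Dvz

    D-antisym : ∀ u v → G u ≡ true → G v ≡ true → D u v ≡ true → D v u ≡ true → u ≡ v
    D-antisym u v Gu Gv Duv Dvu with region u Gu | region v Gv
    ... | at-m refl | at-m refl = refl
    ... | at-m refl | in₁ G₁v = ⊥-elim (≡true⇒≢false (D₁-closed G₁v Dvu) G₁-m)
    ... | in₁ G₁u | at-m refl = ⊥-elim (≡true⇒≢false (D₁-closed G₁u Duv) G₁-m)
    ... | at-m refl | in₂ G₂v = ⊥-elim (≡true⇒≢false (Dm⊆M Duv) (G₂∌M G₂v))
    ... | in₂ G₂u | at-m refl = ⊥-elim (≡true⇒≢false (Dm⊆M Dvu) (G₂∌M G₂u))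
    ... | in₁ G₁u | in₂ G₂v = ⊥-elim (≡true⇒≢false (D₁-closed G₁u Duv) (G₂∌G₁ G₂v))
    ... | in₂ G₂u | in₁ G₁v = ⊥-elim (≡true⇒≢false (D₁-closed G₁v Dvu) (G₂∌G₁ G₂u))
    ... | in₁ G₁u | in₁ G₁v rewrite D-G₁ G₁u | D-G₁ G₁v = F₁.D-antisym u v G₁u G₁v Duv Dvu
    ... | in₂ G₂u | in₂ G₂v rewrite D-G₂ G₂u | D-G₂ G₂v = F₂.D-antisym u v G₂u G₂v Duv Dvu

    family : NestedFamily G
    family = record { D = D ; D-refl = D-refl ; D⊆G = D⊆G ; D-𝓢 = D-𝓢 ; D-nested = D-nested
                    ; D-comparable = D-comparable ; D-antisym = D-antisym }

  module Step (G : BoolSet N) (G-r : G r ≡ false) (covered : Covered G) (separated : Separated G)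
              (x₀ : Fin N) (Gx₀ : G x₀ ≡ true) where

    Inside : BoolSet N → Set
    Inside S = 𝓢 S × S ⊆ᵇ G

    larger? : ∀ n → Dec (∃ λ S → Inside S × n < size S)
    larger? n = ∃BoolSet? (λ S → Inside S × n < size S)
      (λ S≗T ((𝓢S , S⊆G) , n<S) →
        (𝓢-resp S≗T 𝓢S , λ x Tx → S⊆G x (trans (S≗T x) Tx)) , subst (n <_) (size-cong S≗T) n<S)
      (λ S → (𝓢? S ×-dec S ⊆ᵇ? G) ×-dec (n <? size S))

    -- Abstract: unfolding these exhaustive searches during unification is prohibitively slow.
    abstract
      largest : ∃ λ M → Inside M × (∀ S → Inside S → size S ≤ size M)
      largest = let S₀ , 𝓢S₀ , S₀⊆G , _ = covered x₀ Gx₀ in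
        Extremum.maximum Inside size N (λ S _ → size≤ S) larger? S₀ (𝓢S₀ , S₀⊆G)

    M : BoolSet N
    M = proj₁ largest

    𝓢M : 𝓢 M
    𝓢M = proj₁ (proj₁ (proj₂ largest))

    M⊆G : M ⊆ᵇ G
    M⊆G = proj₂ (proj₁ (proj₂ largest))

    M-r : M r ≡ false
    M-r = ⊆ᵇ-respects-false M⊆G G-r

    M-maximal : ∀ S → 𝓢 S → S ⊆ᵇ G → M ⊆ᵇ S → ∀ x → S x ≡ true → M x ≡ false → ⊥
    M-maximal S 𝓢S S⊆G M⊆S x Sx Mx =
      <⇒≱ (⊂ᵇ⇒size< M⊆S x Sx Mx) (proj₂ (proj₂ largest) S (𝓢S , S⊆G))

    M-nonempty : ∃ λ x → M x ≡ true
    M-nonempty = let S₀ , 𝓢S₀ , S₀⊆G , S₀x₀ = covered x₀ Gx₀ in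
      size>0⇒∈ M (≤-trans (∈⇒size>0 x₀ S₀x₀) (proj₂ (proj₂ largest) S₀ (𝓢S₀ , S₀⊆G)))

    -- Uncrossing with the maximal M never produces a strictly larger 𝓢-set, so it moves
    -- any separation of two points of M inside M.
    separate-within-M : ∀ S → 𝓢 S → S ⊆ᵇ G → ∀ a b → M a ≡ true → M b ≡ true → S a ≢ S b →
      ∃ λ S′ → 𝓢 S′ × S′ ⊆ᵇ M × S′ a ≢ S′ b
    separate-within-M S 𝓢S S⊆G a b Ma Mb Sa≢Sb with ⊆ᵇ-or-⊈ᵇ S M
    ... | inj₁ S⊆M = S , 𝓢S , S⊆M , Sa≢Sb
    ... | inj₂ S⊄M with ⊆ᵇ-or-⊈ᵇ M S
    ...   | inj₁ M⊆S = let x , Sx , Mx = S⊄M in ⊥-elim (M-maximal S 𝓢S S⊆G M⊆S x Sx Mx)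
    ...   | inj₂ M⊄S with 𝓢-uncross S M 𝓢S 𝓢M (⊆ᵇ-respects-false S⊆G G-r) M-r
    ...     | inj₁ meet = S ∩ᵇ M , proj₁ (meet S∩M) , (λ _ → ∧≡true⇒ʳ) , Sa≢Sb ∘ ∧-cancelʳ-true Ma Mb
      where
      S∩M : Meets S M
      S∩M = [ (λ Sa → a , Sa , Ma) , (λ Sb → b , Sb , Mb) ]′ (≢⇒one-true Sa≢Sb)
    ...     | inj₂ cross = M ∖ᵇ S , proj₂ (cross (S⊄M , M⊄S)) , (λ _ → ∧≡true⇒ˡ) , Sa≢Sb ∘ ∧-not-cancel-true Ma Mb

    Avoiding : Fin N → Fin N → BoolSet N → Set
    Avoiding m y S = 𝓢 S × S ⊆ᵇ M × S m ≡ false × S y ≡ true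

    Avoiding? : ∀ m y → Dec (∃ (Avoiding m y))
    Avoiding? m y = ∃BoolSet? (Avoiding m y)
      (λ S≗T (𝓢S , S⊆M , Sm , Sy) →
        𝓢-resp S≗T 𝓢S , (λ x Tx → S⊆M x (trans (S≗T x) Tx)) , trans (sym (S≗T m)) Sm , trans (sym (S≗T y)) Sy)
      (λ S → 𝓢? S ×-dec S ⊆ᵇ? M ×-dec (S m 𝔹.≟ false) ×-dec (S y 𝔹.≟ true))

    abstract
      Away : Fin N → BoolSet N
      Away m y = does (Avoiding? m y)

      Away-elim : ∀ {m y} → Away m y ≡ true → ∃ (Avoiding m y)
      Away-elim {m} {y} = does≡true⇒ (Avoiding? m y)

      Away-intro : ∀ {m y} → ∃ (Avoiding m y) → Away m y ≡ true
      Away-intro {m} {y} = dec-true (Avoiding? m y)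

    Away-self : ∀ m → Away m m ≡ false
    Away-self m = ≢true⇒≡false λ h → let _ , _ , _ , Sm , Sm′ = Away-elim h in ≡true⇒≢false Sm′ Sm

    Away⊆M : ∀ m → Away m ⊆ᵇ M
    Away⊆M m y h = let _ , _ , S⊆M , _ , Sy = Away-elim h in S⊆M y Sy

    𝓢⊆Away : ∀ {m S} → 𝓢 S → S ⊆ᵇ M → S m ≡ false → S ⊆ᵇ Away m
    𝓢⊆Away 𝓢S S⊆M Sm y Sy = Away-intro (_ , 𝓢S , S⊆M , Sm , Sy)

    abstract
      most-away : ∃ λ m → M m ≡ true × (∀ a → M a ≡ true → size (Away a) ≤ size (Away m))
      most-away = let x , Mx = M-nonempty in
        Extremum.maximum (λ a → M a ≡ true) (size ∘ Away) N (λ a _ → size≤ (Away a))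
          (λ n → any? λ a → (M a 𝔹.≟ true) ×-dec (n <? size (Away a))) x Mx

    m : Fin N
    m = proj₁ most-away

    M-m : M m ≡ true
    M-m = proj₁ (proj₂ most-away)

    -- If y ∈ M ∖ {m} were not in Away m, then Away m ⊆ Away y and m ∈ Away y,
    -- so Away y would be strictly larger than Away m.
    Away-complete : ∀ y → M y ≡ true → y ≢ m → Away m y ≡ true
    Away-complete y My y≢m with true-or-false (Away m y)
    ... | inj₁ Away-m-y = Away-m-y
    ... | inj₂ ¬Away-m-y =
      ⊥-elim (<⇒≱ (⊂ᵇ⇒size< Away-m⊆Away-y m m∈Away-y (Away-self m)) (proj₂ (proj₂ most-away) y My))
      where
      Away-m⊆Away-y : Away m ⊆ᵇ Away y
      Away-m⊆Away-y z h = let S , 𝓢S , S⊆M , Sm , Sz = Away-elim h in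
        Away-intro (S , 𝓢S , S⊆M , ≢true⇒≡false (λ Sy → ≡true⇒≢false (𝓢⊆Away 𝓢S S⊆M Sm y Sy) ¬Away-m-y) , Sz)
      m∈Away-y : Away y m ≡ true
      m∈Away-y with separated y m (M⊆G y My) (M⊆G m M-m) y≢m
      ... | S , 𝓢S , S⊆G , Sy≢Sm with separate-within-M S 𝓢S S⊆G y m My M-m Sy≢Sm
      ...   | S′ , 𝓢S′ , S′⊆M , S′y≢S′m with ≢⇒one-true S′y≢S′m
      ...     | inj₁ S′y = ⊥-elim (≡true⇒≢false (𝓢⊆Away 𝓢S′ S′⊆M (≢∧true⇒false S′y≢S′m S′y) y S′y) ¬Away-m-y)
      ...     | inj₂ S′m = Away-intro (S′ , 𝓢S′ , S′⊆M , ≢∧true⇒false (S′y≢S′m ∘ sym) S′m , S′m)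

    G₁ : BoolSet N
    G₁ = Away m

    G₁-covered : Covered G₁
    G₁-covered y h = let S , 𝓢S , S⊆M , Sm , Sy = Away-elim h in S , 𝓢S , 𝓢⊆Away 𝓢S S⊆M Sm , Sy

    separate-in-G₁ : ∀ a b → G₁ a ≡ true → ∀ S → 𝓢 S → S ⊆ᵇ M → S m ≡ true → S a ≡ true → S b ≡ false →
      ∃ λ S′ → 𝓢 S′ × S′ ⊆ᵇ G₁ × S′ a ≢ S′ b
    separate-in-G₁ a b G₁a S 𝓢S S⊆M Sm Sa Sb with Away-elim G₁a
    ... | A , 𝓢A , A⊆M , Am , Aa with true-or-false (A b)
    ...   | inj₂ Ab = A , 𝓢A , 𝓢⊆Away 𝓢A A⊆M Am , λ eq → ≡true⇒≢false Aa (trans eq Ab)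
    ...   | inj₁ Ab with 𝓢-uncross A S 𝓢A 𝓢S (⊆ᵇ-respects-false A⊆M M-r) (⊆ᵇ-respects-false S⊆M M-r)
    ...     | inj₁ meet = A ∩ᵇ S , proj₁ (meet (a , Aa , Sa)) , (λ z → 𝓢⊆Away 𝓢A A⊆M Am z ∘ ∧≡true⇒ˡ) ,
                λ eq → ≡true⇒≢false (cong₂ _∧_ Aa Sa) (trans eq (cong₂ _∧_ Ab Sb))
    ...     | inj₂ cross = A ∖ᵇ S , proj₁ (cross ((b , Ab , Sb) , (m , Sm , Am))) ,
                (λ z → 𝓢⊆Away 𝓢A A⊆M Am z ∘ ∧≡true⇒ˡ) ,
                λ eq → ≡true⇒≢false (cong₂ _∧_ Ab (cong not Sb)) (trans (sym eq) (cong₂ _∧_ Aa (cong not Sa)))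

    G₁-separated : Separated G₁
    G₁-separated y y′ G₁y G₁y′ y≢y′ with separated y y′ (M⊆G y (Away⊆M m y G₁y)) (M⊆G y′ (Away⊆M m y′ G₁y′)) y≢y′
    ... | S , 𝓢S , S⊆G , Sy≢Sy′ with separate-within-M S 𝓢S S⊆G y y′ (Away⊆M m y G₁y) (Away⊆M m y′ G₁y′) Sy≢Sy′
    ...   | S′ , 𝓢S′ , S′⊆M , S′y≢S′y′ with true-or-false (S′ m)
    ...     | inj₂ S′m = S′ , 𝓢S′ , 𝓢⊆Away 𝓢S′ S′⊆M S′m , S′y≢S′y′
    ...     | inj₁ S′m with ≢⇒one-true S′y≢S′y′
    ...       | inj₁ S′y = separate-in-G₁ y y′ G₁y S′ 𝓢S′ S′⊆M S′m S′y (≢∧true⇒false S′y≢S′y′ S′y)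
    ...       | inj₂ S′y′ =
      let S″ , 𝓢S″ , S″⊆G₁ , S″y′≢S″y = separate-in-G₁ y′ y G₁y′ S′ 𝓢S′ S′⊆M S′m S′y′
                                          (≢∧true⇒false (S′y≢S′y′ ∘ sym) S′y′)
      in S″ , 𝓢S″ , S″⊆G₁ , S″y′≢S″y ∘ sym

    G₂ : BoolSet N
    G₂ = G ∖ᵇ M

    -- Uncrossing S with M must yield the difference S ∖ M, as the union would beat M.
    shrink-into-G₂ : ∀ S → 𝓢 S → S ⊆ᵇ G → ∀ x → S x ≡ true → M x ≡ false →
      ∃ λ S′ → 𝓢 S′ × S′ ⊆ᵇ G₂ × (∀ z → M z ≡ false → S′ z ≡ S z)
    shrink-into-G₂ S 𝓢S S⊆G x Sx Mx with disjoint-or-meets S M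
    ... | inj₁ S∩M≡∅ = S , 𝓢S , (λ z Sz → ∧≡true⁺ (S⊆G z Sz) (≡false⇒not≡true (S∩M≡∅ z Sz))) , λ _ _ → refl
    ... | inj₂ S∩M with 𝓢-uncross S M 𝓢S 𝓢M (⊆ᵇ-respects-false S⊆G G-r) M-r
    ...   | inj₁ meet = ⊥-elim (M-maximal (S ∪ᵇ M) (proj₂ (meet S∩M))
              (λ z → [ S⊆G z , M⊆G z ]′ ∘ ∨≡true⁻) (λ _ → ∨≡true⁺ʳ) x (∨≡true⁺ˡ Sx) Mx)
    ...   | inj₂ cross with ⊆ᵇ-or-⊈ᵇ M S
    ...     | inj₁ M⊆S = ⊥-elim (M-maximal S 𝓢S S⊆G M⊆S x Sx Mx)
    ...     | inj₂ M⊄S = S ∖ᵇ M , proj₁ (cross ((x , Sx , Mx) , M⊄S)) ,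
                (λ z h → ∧≡true⁺ (S⊆G z (∧≡true⇒ˡ h)) (∧≡true⇒ʳ h)) ,
                λ z Mz → trans (cong (λ t → S z ∧ not t) Mz) (𝔹.∧-identityʳ (S z))

    G₂∌M : ∀ {z} → G₂ z ≡ true → M z ≡ false
    G₂∌M = not≡true⇒ ∘ ∧≡true⇒ʳ

    G₂-covered : Covered G₂
    G₂-covered x G₂x with covered x (∧≡true⇒ˡ G₂x)
    ... | S , 𝓢S , S⊆G , Sx = let S′ , 𝓢S′ , S′⊆G₂ , S′≐S = shrink-into-G₂ S 𝓢S S⊆G x Sx (G₂∌M G₂x)
                             in S′ , 𝓢S′ , S′⊆G₂ , trans (S′≐S x (G₂∌M G₂x)) Sx

    shrunk-separates : ∀ {S : BoolSet N} {y y′} → G₂ y ≡ true → G₂ y′ ≡ true → S y ≢ S y′ →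
      (∃ λ S′ → 𝓢 S′ × S′ ⊆ᵇ G₂ × (∀ z → M z ≡ false → S′ z ≡ S z)) → ∃ λ S′ → 𝓢 S′ × S′ ⊆ᵇ G₂ × S′ y ≢ S′ y′
    shrunk-separates G₂y G₂y′ Sy≢Sy′ (S′ , 𝓢S′ , S′⊆G₂ , S′≐S) =
      S′ , 𝓢S′ , S′⊆G₂ , λ eq → Sy≢Sy′ (trans (sym (S′≐S _ (G₂∌M G₂y))) (trans eq (S′≐S _ (G₂∌M G₂y′))))

    G₂-separated : Separated G₂
    G₂-separated y y′ G₂y G₂y′ y≢y′ with separated y y′ (∧≡true⇒ˡ G₂y) (∧≡true⇒ˡ G₂y′) y≢y′
    ... | S , 𝓢S , S⊆G , Sy≢Sy′ = shrunk-separates {S} G₂y G₂y′ Sy≢Sy′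
      ([ (λ Sy → shrink-into-G₂ S 𝓢S S⊆G y Sy (G₂∌M G₂y)) ,
         (λ Sy′ → shrink-into-G₂ S 𝓢S S⊆G y′ Sy′ (G₂∌M G₂y′)) ]′ (≢⇒one-true Sy≢Sy′))

    G₂⊆G : G₂ ⊆ᵇ G
    G₂⊆G _ = ∧≡true⇒ˡ

    G₁-smaller : size G₁ < size G
    G₁-smaller = ⊂ᵇ⇒size< (⊆ᵇ-trans (Away⊆M m) M⊆G) m (M⊆G m M-m) (Away-self m)

    G₂-smaller : size G₂ < size G
    G₂-smaller = ⊂ᵇ⇒size< G₂⊆G m (M⊆G m M-m) (trans (cong (λ t → G m ∧ not t) M-m) (𝔹.∧-zeroʳ (G m)))

    nestedFamily-step : (∀ H → size H < size G → H r ≡ false → Covered H → Separated H → NestedFamily H) →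
      NestedFamily G
    nestedFamily-step recurse = Glue.family G M G₁ m M-m M⊆G 𝓢M (Away⊆M m) (Away-self m) Away-complete
      (recurse G₁ G₁-smaller (⊆ᵇ-respects-false (Away⊆M m) M-r) G₁-covered G₁-separated)
      (recurse G₂ G₂-smaller (⊆ᵇ-respects-false G₂⊆G G-r) G₂-covered G₂-separated)

  nestedFamily : ∀ G → G r ≡ false → Covered G → Separated G → NestedFamily G
  nestedFamily G = go (size G) G ≤-refl
    where
    go : ∀ n G → size G ≤ n → G r ≡ false → Covered G → Separated G → NestedFamily G
    go zero G G≤0 _ _ _ = nestedFamily-empty G λ x → ≢true⇒≡false λ Gx → <⇒≱ (∈⇒size>0 x Gx) G≤0
    go (suc n) G G≤n G-r covered separated with any? (λ x → G x 𝔹.≟ true)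
    ... | no G≡∅ = nestedFamily-empty G λ x → ≢true⇒≡false λ Gx → G≡∅ (x , Gx)
    ... | yes (x₀ , Gx₀) = Step.nestedFamily-step G G-r covered separated x₀ Gx₀
            λ H H<G → go n H (≤-pred (<-≤-trans H<G G≤n))

-- Walks, paths and the tree of a nested family

module Walks (L : Graph) where

  open Graph L using (p; q)

  Joins-sym : ∀ {e u v} → Joins L e u v → Joins L e v u
  Joins-sym = Data.Sum.swap

  walk-start∈ : ∀ {a b es vs} → Walk L a b es vs → a ∈ₗ vs
  walk-start∈ (here _) = Any.here refl
  walk-start∈ (step _ _ _) = Any.here refl

  walk-++ : ∀ {a b c es es′ vs vs′} → Walk L a b es vs → Walk L b c es′ vs′ →
    ∃ λ vs″ → Walk L a c (es ++ es′) vs″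
  walk-++ (here _) w′ = _ , w′
  walk-++ (step e J w) w′ = _ , step e J (proj₂ (walk-++ w w′))

  walk-reverse : ∀ {a b es vs} → Walk L a b es vs → ∃ λ es′ → ∃ λ vs′ → Walk L b a es′ vs′
  walk-reverse (here v) = [] , _ , here v
  walk-reverse (step e J w) =
    let _ , _ , w⁻¹ = walk-reverse w in _ , walk-++ w⁻¹ (step e (Joins-sym J) (here _))

  path-from-visited : ∀ {a v b es vs} → Walk L v b es vs → a ∈ₗ vs → Unique vs → ∃ λ es′ → Path L a b es′
  path-from-visited w@(here _) (Any.here refl) uniq = _ , _ , w , uniq
  path-from-visited w@(step _ _ _) (Any.here refl) uniq = _ , _ , w , uniq
  path-from-visited (step _ _ w) (Any.there a∈vs) (_ ∷ uniq) = path-from-visited w a∈vs uniq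

  -- Shortcut the walk at the first repeated vertex, working from the end backwards.
  walk⇒path : ∀ {a b es vs} → Walk L a b es vs → ∃ λ es′ → Path L a b es′
  walk⇒path (here v) = [] , (v ∷ []) , here v , ([] ∷ [])
  walk⇒path (step {u = a} e J w) with walk⇒path w
  ... | es′ , vs′ , w′ , uniq with Any.any? (a ≟ᶠ_) vs′
  ...   | yes a∈vs′ = path-from-visited w′ a∈vs′ uniq
  ...   | no a∉vs′ = e ∷ es′ , a ∷ vs′ , step e J w′ , ¬Any⇒All¬ vs′ a∉vs′ ∷ uniq

  Joins-ends : ∀ {e u v a b} → Joins L e u v → Joins L e a b → u ≡ a ⊎ u ≡ b
  Joins-ends (inj₁ uv) (inj₁ ab) = inj₁ (cong proj₁ (trans (sym uv) ab))
  Joins-ends (inj₁ uv) (inj₂ ba) = inj₂ (cong proj₁ (trans (sym uv) ba))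
  Joins-ends (inj₂ vu) (inj₁ ab) = inj₂ (cong proj₂ (trans (sym vu) ab))
  Joins-ends (inj₂ vu) (inj₂ ba) = inj₁ (cong proj₂ (trans (sym vu) ba))

  endpoint-visited : ∀ {a b es vs e u v} → Walk L a b es vs → e ∈ₗ es → Joins L e u v → u ∈ₗ vs
  endpoint-visited (step _ J w) (Any.here refl) J′ with Joins-ends J′ J
  ... | inj₁ refl = Any.here refl
  ... | inj₂ refl = Any.there (walk-start∈ w)
  endpoint-visited (step _ _ w) (Any.there e∈es) J′ = Any.there (endpoint-visited w e∈es J′)

  module Cut (e : Fin q) (side : Fin p → Bool)
    (side-off : ∀ {e′ u v} → Joins L e′ u v → e′ ≢ e → side u ≡ side v)
    (side-on : ∀ {u v} → Joins L e u v → side u ≢ side v) where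

    walk-avoiding-cut : ∀ {a b es vs} → Walk L a b es vs → e ∉ₗ es → side a ≡ side b
    walk-avoiding-cut (here _) _ = refl
    walk-avoiding-cut (step _ J w) e∉es =
      trans (side-off J (e∉es ∘ Any.here ∘ sym)) (walk-avoiding-cut w (e∉es ∘ Any.there))

    -- A path crosses e at most once: a second crossing would revisit its first vertex.
    path-through-cut : ∀ {a b es vs} → Walk L a b es vs → Unique vs → e ∈ₗ es → side a ≢ side b
    path-through-cut (step {es = es} _ J w) (a∉ ∷ _) (Any.here refl) with Any.any? (e ≟ᶠ_) es
    ... | yes e∈es = ⊥-elim (All.lookup a∉ (endpoint-visited w e∈es J) refl)
    ... | no e∉es = λ eq → side-on J (trans eq (sym (walk-avoiding-cut w e∉es)))
    path-through-cut (step e′ J w) (a∉ ∷ uniq) (Any.there e∈es) with e′ ≟ᶠ e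
    ... | yes refl = ⊥-elim (All.lookup a∉ (endpoint-visited w e∈es J) refl)
    ... | no e′≢e = λ eq → path-through-cut w uniq e∈es (trans (sym (side-off J e′≢e)) eq)

nonRoot : ∀ {n} → BoolSet (suc n)
nonRoot zero = false
nonRoot (suc _) = true

-- The nested sets D x (x ≠ 0) become the subtrees of a tree rooted at 0.
module TreeOfNestedSets (n : ℕ) (D : Fin (suc n) → BoolSet (suc n))
  (D-refl : ∀ x → nonRoot x ≡ true → D x x ≡ true)
  (D⊆nonRoot : ∀ x → nonRoot x ≡ true → D x ⊆ᵇ nonRoot)
  (D-nested : ∀ x u → nonRoot x ≡ true → nonRoot u ≡ true → D x u ≡ true → D u ⊆ᵇ D x)
  (D-comparable : ∀ u v z → nonRoot u ≡ true → nonRoot v ≡ true → D u z ≡ true → D v z ≡ true →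
     D u v ≡ true ⊎ D v u ≡ true)
  (D-antisym : ∀ u v → nonRoot u ≡ true → nonRoot v ≡ true → D u v ≡ true → D v u ≡ true → u ≡ v)
  where

  Container : Fin (suc n) → Fin (suc n) → Set
  Container x u = nonRoot u ≡ true × u ≢ x × D u x ≡ true

  Container? : ∀ x u → Dec (Container x u)
  Container? x u = (nonRoot u 𝔹.≟ true) ×-dec ¬? (u ≟ᶠ x) ×-dec (D u x 𝔹.≟ true)

  IsParent : Fin (suc n) → Fin (suc n) → Set
  IsParent x p = (p ≡ zero × (∀ u → ¬ Container x u))
               ⊎ (Container x p × (∀ u → Container x u → size (D p) ≤ size (D u)))

  parent-of : ∀ x → ∃ (IsParent x)
  parent-of x with any? (Container? x)
  ... | no none = zero , inj₁ (refl , λ u c → none (u , c))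
  ... | yes (u , c) =
    let p , cp , p-min = Extremum.minimum (Container x) (size ∘ D)
                           (λ k → any? λ u → Container? x u ×-dec (size (D u) <? k)) u c
    in p , inj₂ (cp , p-min)

  parent : Fin n → Fin (suc n)
  parent i = proj₁ (parent-of (suc i))

  IsParent-parent : ∀ i → IsParent (suc i) (parent i)
  IsParent-parent i = proj₂ (parent-of (suc i))

  tree : Graph
  tree = record { p = suc n ; q = n ; ends = λ i → suc i , parent i }

  below : Fin n → BoolSet (suc n)
  below i = D (suc i)

  D-root : ∀ {a} → nonRoot a ≡ true → D a zero ≡ false
  D-root {a} h = ≢true⇒≡false λ t → ≡true⇒≢false (D⊆nonRoot a h zero t) refl

  below-self : ∀ i → below i (suc i) ≡ true
  below-self i = D-refl (suc i) refl

  below-parent : ∀ i → below i (parent i) ≡ false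
  below-parent i with IsParent-parent i
  ... | inj₁ (p≡0 , _) rewrite p≡0 = D-root refl
  ... | inj₂ ((p-nonRoot , p≢i , Dpi) , _) =
    ≢true⇒≡false λ Dip → p≢i (sym (D-antisym (suc i) (parent i) refl p-nonRoot Dip Dpi))

  below-other-edge : ∀ i j → j ≢ i → below i (suc j) ≡ below i (parent j)
  below-other-edge i j j≢i with true-or-false (D (suc i) (suc j))
  ... | inj₁ Dij = inside (IsParent-parent j)
    where
    inside : IsParent (suc j) (parent j) → below i (suc j) ≡ below i (parent j)
    inside (inj₁ (_ , none)) = ⊥-elim (none (suc i) (refl , j≢i ∘ sym ∘ suc-injective , Dij))
    inside (inj₂ ((p-nonRoot , _ , Dpj) , p-min))
      with D-comparable (parent j) (suc i) (suc j) p-nonRoot refl Dpj Dij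
    ... | inj₂ Dip = trans Dij (sym Dip)
    ... | inj₁ Dpi with true-or-false (D (suc i) (parent j))
    ...   | inj₁ Dip = trans Dij (sym Dip)
    ...   | inj₂ ¬Dip = ⊥-elim (<⇒≱ (⊂ᵇ⇒size< (D-nested (parent j) (suc i) p-nonRoot refl Dpi) (parent j)
                                               (D-refl (parent j) p-nonRoot) ¬Dip)
                                    (p-min (suc i) (refl , j≢i ∘ sym ∘ suc-injective , Dij)))
  ... | inj₂ ¬Dij = trans ¬Dij (sym (outside (IsParent-parent j)))
    where
    outside : IsParent (suc j) (parent j) → below i (parent j) ≡ false
    outside (inj₁ (p≡0 , _)) rewrite p≡0 = D-root refl
    outside (inj₂ ((p-nonRoot , _ , Dpj) , _)) =
      ≢true⇒≡false λ Dip → ≡true⇒≢false (D-nested (suc i) (parent j) refl p-nonRoot Dip (suc j) Dpj) ¬Dij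

  extent : Fin (suc n) → BoolSet (suc n)
  extent zero = λ _ → true
  extent (suc k) = D (suc k)

  parent-larger : ∀ i → size (extent (suc i)) < size (extent (parent i))
  parent-larger i with IsParent-parent i
  ... | inj₁ (p≡0 , _) rewrite p≡0 = ⊂ᵇ⇒size< {S = D (suc i)} {T = extent zero} (λ _ _ → refl) zero refl (D-root refl)
  ... | inj₂ ((p-nonRoot , _ , Dpi) , _) = strictly (parent i) p-nonRoot Dpi (below-parent i)
    where
    strictly : ∀ p → nonRoot p ≡ true → D p (suc i) ≡ true → D (suc i) p ≡ false →
      size (D (suc i)) < size (extent p)
    strictly (suc k) p-nonRoot Dpi ¬Dip =
      ⊂ᵇ⇒size< (D-nested (suc k) (suc i) p-nonRoot refl Dpi) (suc k) (D-refl (suc k) p-nonRoot) ¬Dip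

  open Walks tree

  walk-to-root : ∀ x → ∃ λ es → ∃ λ vs → Walk tree x zero es vs
  walk-to-root x = go (suc n) x (m∸n≤m (suc n) (size (extent x)))
    where
    go : ∀ fuel x → suc n ∸ size (extent x) ≤ fuel → ∃ λ es → ∃ λ vs → Walk tree x zero es vs
    go _ zero _ = [] , _ , here zero
    go zero (suc i) gap =
      ⊥-elim (<⇒≱ (∸-monoʳ-< (parent-larger i) (size≤ (extent (parent i)))) (≤-trans gap z≤n))
    go (suc fuel) (suc i) gap =
      let es , vs , w = go fuel (parent i)
                          (≤-pred (<-≤-trans (∸-monoʳ-< (parent-larger i) (size≤ (extent (parent i)))) gap))
      in i ∷ es , _ , step i (inj₁ refl) w

  tree-connected : Connected tree
  tree-connected u v =
    let _ , _ , u→0 = walk-to-root u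
        _ , _ , v→0 = walk-to-root v
        _ , _ , 0→v = walk-reverse v→0
    in walk⇒path (proj₂ (walk-++ u→0 0→v))

  below-off : ∀ i {j u v} → Joins tree j u v → j ≢ i → below i u ≡ below i v
  below-off i {j} (inj₁ refl) j≢i = below-other-edge i j j≢i
  below-off i {j} (inj₂ refl) j≢i = sym (below-other-edge i j j≢i)

  below-on : ∀ i {u v} → Joins tree i u v → below i u ≢ below i v
  below-on i (inj₁ refl) eq = ≡true⇒≢false (trans (sym eq) (below-self i)) (below-parent i)
  below-on i (inj₂ refl) eq = ≡true⇒≢false (trans eq (below-self i)) (below-parent i)

  module Cutᵢ (i : Fin n) = Cut i (below i) (below-off i) (below-on i)

  tree-simple : Simple tree
  tree-simple = (λ i eq → below-on i (inj₁ refl) (cong (below i) eq))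
              , (λ i j i≢j J → below-on i (inj₁ refl) (below-off i J (i≢j ∘ sym)))

  tree-acyclic : ¬ HasCycle tree
  tree-acyclic (i , u , v , _ , J , (_ , w , _) , i∉es , _) = below-on i J (sym (Cutᵢ.walk-avoiding-cut i w i∉es))

  tree-isTree : IsTree tree
  tree-isTree = tree-simple , tree-connected , tree-acyclic

  path-crossing-separates : ∀ {t t′ es} → Path tree t t′ es → ∀ {i} → i ∈ₗ es → below i t ≢ below i t′
  path-crossing-separates (_ , w , uniq) {i} = Cutᵢ.path-through-cut i w uniq

  InComponentMinus-refl : ∀ i s → InComponentMinus tree i s s
  InComponentMinus-refl i s = [] , (s ∷ [] , here s , [] ∷ []) , λ ()

-- Vertex sets and directed separations

lookup⇒≡⊤ : ∀ {n} (p : Subset n) → (∀ v → lookup p v ≡ true) → p ≡ ⊤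
lookup⇒≡⊤ [] _ = refl
lookup⇒≡⊤ (x ∷ p) h = cong₂ _∷_ (h zero) (lookup⇒≡⊤ p (h ∘ suc))

module _ {n : ℕ} where

  ∉⇒lookup : ∀ {p : Subset n} {v} → v ∉ p → lookup p v ≡ false
  ∉⇒lookup {p} {v} v∉p = ≢true⇒≡false (v∉p ∘ lookup⇒[]= v p)

  lookup-∩ : ∀ (p q : Subset n) v → lookup (p ∩ q) v ≡ lookup p v ∧ lookup q v
  lookup-∩ p q v = lookup-zipWith _∧_ v p q

  lookup-∪ : ∀ (p q : Subset n) v → lookup (p ∪ q) v ≡ lookup p v ∨ lookup q v
  lookup-∪ p q v = lookup-zipWith _∨_ v p q

  ≡⊤⇒lookup : ∀ {p : Subset n} → p ≡ ⊤ → ∀ v → lookup p v ≡ true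
  ≡⊤⇒lookup refl v = lookup-replicate v true

  ∪≡⊤⇒lookup : ∀ {p q : Subset n} → p ∪ q ≡ ⊤ → ∀ v → lookup p v ∨ lookup q v ≡ true
  ∪≡⊤⇒lookup {p} {q} p∪q≡⊤ v = trans (sym (lookup-∪ p q v)) (≡⊤⇒lookup p∪q≡⊤ v)

  lookup⇒∪≡⊤ : ∀ (p q : Subset n) → (∀ v → lookup p v ∨ lookup q v ≡ true) → p ∪ q ≡ ⊤
  lookup⇒∪≡⊤ p q h = lookup⇒≡⊤ (p ∪ q) λ v → trans (lookup-∪ p q v) (h v)

∣∣≡size : ∀ {n} (p : Subset n) → ∣ p ∣ ≡ size (lookup p)
∣∣≡size [] = refl
∣∣≡size (true ∷ p) = cong suc (∣∣≡size p)
∣∣≡size (false ∷ p) = ∣∣≡size p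

∣∩[∪⁅⁆]∣≡suc : ∀ {n} (p q : Subset n) v → lookup p v ≡ true → lookup q v ≡ false →
  ∣ p ∩ (q ∪ ⁅ v ⁆) ∣ ≡ suc ∣ p ∩ q ∣
∣∩[∪⁅⁆]∣≡suc p q v pv qv = begin
  ∣ p ∩ (q ∪ ⁅ v ⁆) ∣                  ≡⟨ ∣∣≡size (p ∩ (q ∪ ⁅ v ⁆)) ⟩
  size (lookup (p ∩ (q ∪ ⁅ v ⁆)))     ≡⟨ size-insert (lookup (p ∩ q)) (lookup (p ∩ (q ∪ ⁅ v ⁆))) v same at-v at-v′ ⟩
  suc (size (lookup (p ∩ q)))         ≡⟨ cong suc (∣∣≡size (p ∩ q)) ⟨
  suc ∣ p ∩ q ∣                        ∎
  where
  open ≡-Reasoning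
  same : ∀ w → w ≢ v → lookup (p ∩ q) w ≡ lookup (p ∩ (q ∪ ⁅ v ⁆)) w
  same w w≢v = begin
    lookup (p ∩ q) w                              ≡⟨ lookup-∩ p q w ⟩
    lookup p w ∧ lookup q w                       ≡⟨ cong (lookup p w ∧_) (𝔹.∨-identityʳ (lookup q w)) ⟨
    lookup p w ∧ (lookup q w ∨ false)             ≡⟨ cong (λ b → lookup p w ∧ (lookup q w ∨ b)) (∉⇒lookup (x≢y⇒x∉⁅y⁆ w≢v)) ⟨
    lookup p w ∧ (lookup q w ∨ lookup ⁅ v ⁆ w)     ≡⟨ cong (lookup p w ∧_) (lookup-∪ q ⁅ v ⁆ w) ⟨
    lookup p w ∧ lookup (q ∪ ⁅ v ⁆) w              ≡⟨ lookup-∩ p (q ∪ ⁅ v ⁆) w ⟨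
    lookup (p ∩ (q ∪ ⁅ v ⁆)) w                     ∎
  at-v : lookup (p ∩ q) v ≡ false
  at-v = trans (lookup-∩ p q v) (cong₂ _∧_ pv qv)
  at-v′ : lookup (p ∩ (q ∪ ⁅ v ⁆)) v ≡ true
  at-v′ = trans (lookup-∩ p (q ∪ ⁅ v ⁆) v)
    (∧≡true⁺ pv (trans (lookup-∪ q ⁅ v ⁆ v) (∨≡true⁺ʳ ([]=⇒lookup (x∈⁅x⁆ v)))))

module Separations (Gr : Digraph) where

  open Digraph Gr
  open Subgraph

  Side : Subgraph Gr → BoolSet n
  Side A = lookup (V A)

  IsDirSep⇒cover : ∀ {A B} → IsDirSep Gr (A , B) → ∀ v → Side A v ∨ Side B v ≡ true
  IsDirSep⇒cover (_ , _ , A∪B≡⊤ , _) = ∪≡⊤⇒lookup A∪B≡⊤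

  IsDirSep-swap : ∀ {s} → IsDirSep Gr s → IsDirSep Gr (swap s)
  IsDirSep-swap {A , B} ds@(A-sub , B-sub , _ , no-edge) =
    B-sub , A-sub ,
    lookup⇒∪≡⊤ (V B) (V A) (λ v → trans (𝔹.∨-comm (Side B v) (Side A v)) (IsDirSep⇒cover ds v)) ,
    Data.Sum.swap no-edge

  order-swap : ∀ (s : Pair Gr) → order (swap s) ≡ order s
  order-swap (A , B) = cong ∣_∣ (∩-comm (V B) (V A))

  _⊑_ : Pair Gr → Pair Gr → Set
  (A , B) ⊑ (A′ , B′) = Side A ⊆ᵇ Side A′ × Side B ⊆ᵇ Side B′

  enlarge : ∀ {A B} → IsDirSep Gr (A , B) → ∀ v → Side A v ≡ true → Side B v ≡ false →
    Σ (Pair Gr) λ s′ → IsDirSep Gr s′ × order s′ ≡ suc (order (A , B)) × (A , B) ⊑ s′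
  enlarge {A} {B} ds@(A-sub , B-sub , _ , no-edge) v Av Bv =
    (A , B′) , (A-sub , B′-sub , cover , no-edge′ no-edge) , order-B′ , (λ _ → id) , B⊆B′
    where
    B′ : Subgraph Gr
    B′ = subgraph (V B ∪ ⁅ v ⁆) (E B)
    B⊆B′ : Side B ⊆ᵇ Side B′
    B⊆B′ w Bw = trans (lookup-∪ (V B) ⁅ v ⁆ w) (∨≡true⁺ˡ Bw)
    into-B′ : ∀ {w} → w ∈ V B → w ∈ V B′
    into-B′ = x∈p∪q⁺ ∘ inj₁
    from-B′ : ∀ {w} → w ∈ V B′ → w ∉ V A → w ∈ V B
    from-B′ {w} w∈B′ w∉A with x∈p∪q⁻ (V B) ⁅ v ⁆ w∈B′
    ... | inj₁ w∈B = w∈B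
    ... | inj₂ w∈⁅v⁆ rewrite x∈⁅y⁆⇒x≡y v w∈⁅v⁆ = ⊥-elim (w∉A (lookup⇒[]= v (V A) Av))
    B′-sub : IsSubgraph Gr B′
    B′-sub e e∈B = let t , h = B-sub e e∈B in into-B′ t , into-B′ h
    cover : V A ∪ V B′ ≡ ⊤
    cover = lookup⇒∪≡⊤ (V A) (V B′) λ w → [ ∨≡true⁺ˡ , ∨≡true⁺ʳ ∘ B⊆B′ w ]′ (∨≡true⁻ (IsDirSep⇒cover ds w))
    no-edge′ : NoEdgeFromTo Gr A B ⊎ NoEdgeFromTo Gr B A → NoEdgeFromTo Gr A B′ ⊎ NoEdgeFromTo Gr B′ A
    no-edge′ (inj₁ A↛B) = inj₁ λ e (tA , t∉B′ , hB′ , h∉A) →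
      A↛B e (tA , t∉B′ ∘ into-B′ , from-B′ hB′ h∉A , h∉A)
    no-edge′ (inj₂ B↛A) = inj₂ λ e (tB′ , t∉A , hA , h∉B′) →
      B↛A e (from-B′ tB′ t∉A , t∉A , hA , h∉B′ ∘ into-B′)
    order-B′ : order (A , B′) ≡ suc (order (A , B))
    order-B′ = ∣∩[∪⁅⁆]∣≡suc (V A) (V B) v Av Bv

  enlarge-at : ∀ {s} → IsDirSep Gr s → ∀ v → lookup (V (proj₁ s) ∩ V (proj₂ s)) v ≡ false →
    Σ (Pair Gr) λ s′ → IsDirSep Gr s′ × order s′ ≡ suc (order s) × s ⊑ s′
  enlarge-at {A , B} ds v v∉A∩B with ∨≡true⁻ (IsDirSep⇒cover ds v)
  ... | inj₁ Av = enlarge ds v Av (∧≡false⇒ʳ (trans (sym (lookup-∩ (V A) (V B) v)) v∉A∩B) Av)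
  ... | inj₂ Bv =
    let (A′ , B′) , ds′ , o′ , A⊆A′ , B⊆B′ =
          enlarge (IsDirSep-swap ds) v Bv (∧≡false⇒ˡ (trans (sym (lookup-∩ (V A) (V B) v)) v∉A∩B) Bv)
    in (B′ , A′) , IsDirSep-swap ds′ , trans (order-swap (A′ , B′)) (trans o′ (cong suc (order-swap (A , B)))) ,
       B⊆B′ , A⊆A′

  bare : Subset n → Subset n → Pair Gr
  bare P Q = subgraph P ∅ , subgraph Q ∅

  Forward : Subset n → Subset n → Set
  Forward P Q = P ∪ Q ≡ ⊤ × NoEdgeFromTo Gr (subgraph P ∅) (subgraph Q ∅)

  Forward⇒IsDirSep : ∀ {P Q} → Forward P Q → IsDirSep Gr (bare P Q)
  Forward⇒IsDirSep (cover , no-edge) = (λ _ e∈∅ → ⊥-elim (∉⊥ e∈∅)) , (λ _ e∈∅ → ⊥-elim (∉⊥ e∈∅)) , cover , inj₁ no-edge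

  ∪≡⊤⇒∉ˡ⇒∈ʳ : ∀ {P Q : Subset n} {v} → P ∪ Q ≡ ⊤ → v ∉ P → v ∈ Q
  ∪≡⊤⇒∉ˡ⇒∈ʳ {P} {Q} {v} cover v∉P =
    lookup⇒[]= v Q ([ (λ Pv → ⊥-elim (v∉P (lookup⇒[]= v P Pv))) , id ]′ (∨≡true⁻ (∪≡⊤⇒lookup cover v)))

  ∪≡⊤⇒∉ʳ⇒∈ˡ : ∀ {P Q : Subset n} {v} → P ∪ Q ≡ ⊤ → v ∉ Q → v ∈ P
  ∪≡⊤⇒∉ʳ⇒∈ˡ {P} {Q} {v} cover v∉Q =
    lookup⇒[]= v P ([ id , (λ Qv → ⊥-elim (v∉Q (lookup⇒[]= v Q Qv))) ]′ (∨≡true⁻ (∪≡⊤⇒lookup cover v)))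

  module Corners {P₁ Q₁ P₂ Q₂ : Subset n} (f₁ : Forward P₁ Q₁) (f₂ : Forward P₂ Q₂) where

    cover₁ : ∀ v → lookup P₁ v ∨ lookup Q₁ v ≡ true
    cover₁ = ∪≡⊤⇒lookup (proj₁ f₁)

    cover₂ : ∀ v → lookup P₂ v ∨ lookup Q₂ v ≡ true
    cover₂ = ∪≡⊤⇒lookup (proj₁ f₂)

    covered : ∀ φ → CoveredTautology φ ≡ true → ∀ v → φ (lookup P₁ v) (lookup Q₁ v) (lookup P₂ v) (lookup Q₂ v) ≡ true
    covered φ taut v = coveredTautology φ taut _ _ _ _ (cover₁ v) (cover₂ v)

    Forward-∩∪ : Forward (P₁ ∩ P₂) (Q₁ ∪ Q₂)
    Forward-∩∪ = lookup⇒∪≡⊤ (P₁ ∩ P₂) (Q₁ ∪ Q₂) cover , no-edge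
      where
      cover : ∀ v → lookup (P₁ ∩ P₂) v ∨ lookup (Q₁ ∪ Q₂) v ≡ true
      cover v rewrite lookup-∩ P₁ P₂ v | lookup-∪ Q₁ Q₂ v = covered (λ a b c d → (a ∧ c) ∨ (b ∨ d)) refl v
      no-edge : NoEdgeFromTo Gr (subgraph (P₁ ∩ P₂) ∅) (subgraph (Q₁ ∪ Q₂) ∅)
      no-edge e (t∈P , t∉Q , h∈Q , h∉P) with x∈p∩q⁻ P₁ P₂ t∈P | head e ∈? P₁
      ... | tP₁ , _ | no h∉P₁ = proj₂ f₁ e (tP₁ , t∉Q ∘ x∈p∪q⁺ ∘ inj₁ , ∪≡⊤⇒∉ˡ⇒∈ʳ (proj₁ f₁) h∉P₁ , h∉P₁)
      ... | _ , tP₂ | yes h∈P₁ = let h∉P₂ = λ h∈P₂ → h∉P (x∈p∩q⁺ (h∈P₁ , h∈P₂)) in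
        proj₂ f₂ e (tP₂ , t∉Q ∘ x∈p∪q⁺ ∘ inj₂ , ∪≡⊤⇒∉ˡ⇒∈ʳ (proj₁ f₂) h∉P₂ , h∉P₂)

    Forward-∪∩ : Forward (P₁ ∪ P₂) (Q₁ ∩ Q₂)
    Forward-∪∩ = lookup⇒∪≡⊤ (P₁ ∪ P₂) (Q₁ ∩ Q₂) cover , no-edge
      where
      cover : ∀ v → lookup (P₁ ∪ P₂) v ∨ lookup (Q₁ ∩ Q₂) v ≡ true
      cover v rewrite lookup-∪ P₁ P₂ v | lookup-∩ Q₁ Q₂ v = covered (λ a b c d → (a ∨ c) ∨ (b ∧ d)) refl v
      no-edge : NoEdgeFromTo Gr (subgraph (P₁ ∪ P₂) ∅) (subgraph (Q₁ ∩ Q₂) ∅)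
      no-edge e (t∈P , t∉Q , h∈Q , h∉P) with x∈p∩q⁻ Q₁ Q₂ h∈Q | tail e ∈? Q₁
      ... | hQ₁ , _ | no t∉Q₁ = proj₂ f₁ e (∪≡⊤⇒∉ʳ⇒∈ˡ (proj₁ f₁) t∉Q₁ , t∉Q₁ , hQ₁ , h∉P ∘ x∈p∪q⁺ ∘ inj₁)
      ... | _ , hQ₂ | yes t∈Q₁ = let t∉Q₂ = λ t∈Q₂ → t∉Q (x∈p∩q⁺ (t∈Q₁ , t∈Q₂)) in
        proj₂ f₂ e (∪≡⊤⇒∉ʳ⇒∈ˡ (proj₁ f₂) t∉Q₂ , t∉Q₂ , hQ₂ , h∉P ∘ x∈p∪q⁺ ∘ inj₂)

    ∩∪ ∪∩ : Pair Gr
    ∩∪ = bare (P₁ ∩ P₂) (Q₁ ∪ Q₂)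
    ∪∩ = bare (P₁ ∪ P₂) (Q₁ ∩ Q₂)

    corners-submodular : order ∩∪ + order ∪∩ ≤ order (bare P₁ Q₁) + order (bare P₂ Q₂)
    corners-submodular =
      subst₂ _≤_ (sym (cong₂ _+_ (∣∣≡size ((P₁ ∩ P₂) ∩ (Q₁ ∪ Q₂))) (∣∣≡size ((P₁ ∪ P₂) ∩ (Q₁ ∩ Q₂)))))
                 (sym (cong₂ _+_ (∣∣≡size (P₁ ∩ Q₁)) (∣∣≡size (P₂ ∩ Q₂))))
        (size-pointwise-≤ _ _ _ _ pointwise)
      where
      pointwise : ∀ v → count (lookup ((P₁ ∩ P₂) ∩ (Q₁ ∪ Q₂)) v) + count (lookup ((P₁ ∪ P₂) ∩ (Q₁ ∩ Q₂)) v)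
                      ≤ count (lookup (P₁ ∩ Q₁) v) + count (lookup (P₂ ∩ Q₂) v)
      pointwise v
        rewrite lookup-∩ (P₁ ∩ P₂) (Q₁ ∪ Q₂) v | lookup-∩ (P₁ ∪ P₂) (Q₁ ∩ Q₂) v
              | lookup-∩ P₁ P₂ v | lookup-∪ Q₁ Q₂ v | lookup-∪ P₁ P₂ v | lookup-∩ Q₁ Q₂ v
              | lookup-∩ P₁ Q₁ v | lookup-∩ P₂ Q₂ v
        = ≤ᵇ⇒≤ _ _ (Equivalence.from 𝔹.T-≡ (covered
            (λ a b c d → (count ((a ∧ c) ∧ (b ∨ d)) + count ((a ∨ c) ∧ (b ∧ d))) ≤ᵇ (count (a ∧ b) + count (c ∧ d)))
            refl v))

-- Tangles

module TangleFacts (Gr : Digraph) (l k : ℕ) (T : SepSet Gr) (l<k : l < k) (tangle : IsTangle Gr k T) where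

  open Subgraph
  open Separations Gr

  orient : ∀ s → IsDirSep Gr s → order s ≤ l → T s ⊎ T (swap s)
  orient s ds o = proj₁ (proj₂ tangle) s ds (≤-<-trans o l<k)

  small-sides-cover-nothing : ∀ {A₁ B₁ A₂ B₂ A₃ B₃} → T (A₁ , B₁) → T (A₂ , B₂) → T (A₃ , B₃) →
    (∀ v → Side A₁ v ∨ (Side A₂ v ∨ Side A₃ v) ≡ true) → ⊥
  small-sides-cover-nothing {A₁} {B₁} {A₂} {B₂} {A₃} {B₃} t₁ t₂ t₃ cover =
    proj₂ (proj₂ tangle) A₁ B₁ A₂ B₂ A₃ B₃ t₁ t₂ t₃ (lookup⇒≡⊤ _ λ v →
      trans (lookup-∪ (V A₁) _ v) (trans (cong (Side A₁ v ∨_) (lookup-∪ (V A₂) (V A₃) v)) (cover v)))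

  not-both : ∀ {s} → IsDirSep Gr s → T s → T (swap s) → ⊥
  not-both {A , B} ds t t⁻¹ = small-sides-cover-nothing t t⁻¹ t λ v →
    [ ∨≡true⁺ˡ {Side A v} , ∨≡true⁺ʳ {Side A v} ∘ ∨≡true⁺ˡ {Side B v} ]′ (∨≡true⁻ (IsDirSep⇒cover ds v))

  T? : ∀ s → IsDirSep Gr s → order s ≤ l → Dec (T s)
  T? s ds o with orient s ds o
  ... | inj₁ t = yes t
  ... | inj₂ t⁻¹ = no λ t → not-both ds t t⁻¹

  forced : ∀ {A₁ B₁ A₂ B₂ A B} → T (A₁ , B₁) → T (A₂ , B₂) → IsDirSep Gr (A , B) → order (A , B) ≤ l →
    (∀ v → Side A₁ v ∨ (Side A₂ v ∨ Side B v) ≡ true) → T (A , B)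
  forced t₁ t₂ ds o cover with orient _ ds o
  ... | inj₁ t = t
  ... | inj₂ t⁻¹ = ⊥-elim (small-sides-cover-nothing t₁ t₂ t⁻¹ cover)

  T-mono : ∀ {s s′} → IsDirSep Gr s → IsDirSep Gr s′ → order s′ ≤ l → s ⊑ s′ → T s → T s′
  T-mono {A , B} {s′} ds ds′ o (_ , B⊆B′) t = forced t t ds′ o λ v →
    [ ∨≡true⁺ˡ {Side A v} , ∨≡true⁺ʳ {Side A v} ∘ ∨≡true⁺ʳ {Side A v} ∘ B⊆B′ v ]′
      (∨≡true⁻ (IsDirSep⇒cover ds v))

module Tangles (Gr : Digraph) (l N : ℕ) (𝒯 : Fin N → SepSet Gr)
  (tangles : ∀ i → ∃[ k ] (l < k × IsTangle Gr k (𝒯 i)))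
  (distinguishability : ∀ i j → i ≢ j → Distinguishable Gr l (𝒯 i) (𝒯 j) ×
     (∀ j′ → suc j′ ≡ l → ¬ Distinguishable Gr j′ (𝒯 i) (𝒯 j))) where

  open Subgraph
  open Separations Gr

  module 𝒯ᵢ (x : Fin N) = TangleFacts Gr l (proj₁ (tangles x)) (𝒯 x) (proj₁ (proj₂ (tangles x))) (proj₂ (proj₂ (tangles x)))

  -- Enlarge the distinguisher one vertex at a time until its order is l - 1.
  raise-distinguisher : ∀ d {x y s} → IsDirSep Gr s → 𝒯 x s → 𝒯 y (swap s) → ∀ {l′} → suc l′ ≡ l →
    order s + d ≡ l′ → Distinguishable Gr l′ (𝒯 x) (𝒯 y)
  raise-distinguisher zero {s = s} ds tx ty _ o = s , ds , trans (sym (+-identityʳ _)) o , inj₁ (tx , ty)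
  raise-distinguisher (suc d) {x} {y} {A , B} ds tx ty {l′} sl′≡l o
    with any? (λ v → lookup (V A ∩ V B) v 𝔹.≟ false)
  ... | no A∩B≡V = ⊥-elim (𝒯ᵢ.small-sides-cover-nothing x tx tx tx λ v → ∨≡true⁺ˡ {Side A v}
          (∧≡true⇒ˡ (trans (sym (lookup-∩ (V A) (V B) v)) (≢false⇒≡true λ v∉ → A∩B≡V (v , v∉)))))
  ... | yes (v , v∉A∩B) =
    let s′ , ds′ , o′ , s⊑s′ = enlarge-at ds v v∉A∩B
        o′+d : order s′ + d ≡ l′
        o′+d = trans (cong (_+ d) o′) (trans (sym (+-suc (order (A , B)) d)) o)
        o′≤l : order s′ ≤ l
        o′≤l = ≤-trans (m≤m+n (order s′) d) (≤-trans (≤-reflexive o′+d) (≤-trans (n≤1+n l′) (≤-reflexive sl′≡l)))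
    in raise-distinguisher d ds′
         (𝒯ᵢ.T-mono x ds ds′ o′≤l s⊑s′ tx)
         (𝒯ᵢ.T-mono y (IsDirSep-swap ds) (IsDirSep-swap ds′) (≤-trans (≤-reflexive (order-swap s′)) o′≤l)
            (swap s⊑s′) ty)
         sl′≡l o′+d

  distinguisher-order≥l : ∀ {x y s} → IsDirSep Gr s → 𝒯 x s → 𝒯 y (swap s) → l ≤ order s
  distinguisher-order≥l {x} {y} {s} ds tx ty = ≮⇒≥ (below l refl)
    where
    below : ∀ l₀ → l₀ ≡ l → order s < l₀ → ⊥
    below (suc l′) sl′≡l o<l =
      proj₂ (distinguishability x y λ { refl → 𝒯ᵢ.not-both x ds tx ty }) l′ sl′≡l
        (raise-distinguisher (l′ ∸ order s) ds tx ty sl′≡l (m+[n∸m]≡n (≤-pred o<l)))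

  module CornerOrientations {P₁ Q₁ P₂ Q₂ : Subset (Digraph.n Gr)} (f₁ : Forward P₁ Q₁) (f₂ : Forward P₂ Q₂) where

    open Corners f₁ f₂ public

    c₁ c₂ : Pair Gr
    c₁ = bare P₁ Q₁
    c₂ = bare P₂ Q₂

    ds-∩∪ : IsDirSep Gr ∩∪
    ds-∩∪ = Forward⇒IsDirSep Forward-∩∪

    ds-∪∩ : IsDirSep Gr ∪∩
    ds-∪∩ = Forward⇒IsDirSep Forward-∪∩

    ≤l-swap : ∀ s → order s ≤ l → order (swap s) ≤ l
    ≤l-swap s = ≤-trans (≤-reflexive (order-swap s))

    ∩∪-towards-P : ∀ x → 𝒯 x (swap c₁) → 𝒯 x (swap c₂) → order ∩∪ ≤ l → 𝒯 x (swap ∩∪)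
    ∩∪-towards-P x t₁ t₂ o = 𝒯ᵢ.forced x t₁ t₂ (IsDirSep-swap ds-∩∪) (≤l-swap ∩∪ o) λ v →
      trans (cong (λ z → lookup Q₁ v ∨ (lookup Q₂ v ∨ z)) (lookup-∩ P₁ P₂ v))
            (covered (λ a b c d → b ∨ (d ∨ (a ∧ c))) refl v)

    ∩∪-towards-Q₁ : ∀ x → 𝒯 x c₁ → order ∩∪ ≤ l → 𝒯 x ∩∪
    ∩∪-towards-Q₁ x t₁ o = 𝒯ᵢ.forced x t₁ t₁ ds-∩∪ o λ v →
      trans (cong (λ z → lookup P₁ v ∨ (lookup P₁ v ∨ z)) (lookup-∪ Q₁ Q₂ v))
            (covered (λ a b c d → a ∨ (a ∨ (b ∨ d))) refl v)

    ∩∪-towards-Q₂ : ∀ x → 𝒯 x c₂ → order ∩∪ ≤ l → 𝒯 x ∩∪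
    ∩∪-towards-Q₂ x t₂ o = 𝒯ᵢ.forced x t₂ t₂ ds-∩∪ o λ v →
      trans (cong (λ z → lookup P₂ v ∨ (lookup P₂ v ∨ z)) (lookup-∪ Q₁ Q₂ v))
            (covered (λ a b c d → c ∨ (c ∨ (b ∨ d))) refl v)

    ∪∩-towards-Q : ∀ x → 𝒯 x c₁ → 𝒯 x c₂ → order ∪∩ ≤ l → 𝒯 x ∪∩
    ∪∩-towards-Q x t₁ t₂ o = 𝒯ᵢ.forced x t₁ t₂ ds-∪∩ o λ v →
      trans (cong (λ z → lookup P₁ v ∨ (lookup P₂ v ∨ z)) (lookup-∩ Q₁ Q₂ v))
            (covered (λ a b c d → a ∨ (c ∨ (b ∧ d))) refl v)

    ∪∩-towards-P₁ : ∀ x → 𝒯 x (swap c₁) → order ∪∩ ≤ l → 𝒯 x (swap ∪∩)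
    ∪∩-towards-P₁ x t₁ o = 𝒯ᵢ.forced x t₁ t₁ (IsDirSep-swap ds-∪∩) (≤l-swap ∪∩ o) λ v →
      trans (cong (λ z → lookup Q₁ v ∨ (lookup Q₁ v ∨ z)) (lookup-∪ P₁ P₂ v))
            (covered (λ a b c d → b ∨ (b ∨ (a ∨ c))) refl v)

    ∪∩-towards-P₂ : ∀ x → 𝒯 x (swap c₂) → order ∪∩ ≤ l → 𝒯 x (swap ∪∩)
    ∪∩-towards-P₂ x t₂ o = 𝒯ᵢ.forced x t₂ t₂ (IsDirSep-swap ds-∪∩) (≤l-swap ∪∩ o) λ v →
      trans (cong (λ z → lookup Q₂ v ∨ (lookup Q₂ v ∨ z)) (lookup-∪ P₁ P₂ v))
            (covered (λ a b c d → d ∨ (d ∨ (a ∨ c))) refl v)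

    -- If x lies on the P-side and y on the Q-side of both order-l separations, each corner
    -- distinguishes x from y, so has order ≥ l; by submodularity both have order exactly l.
    corners-order-l : order c₁ ≡ l → order c₂ ≡ l → ∀ x y →
      𝒯 x (swap c₁) → 𝒯 x (swap c₂) → 𝒯 y c₁ → 𝒯 y c₂ → order ∩∪ ≡ l × order ∪∩ ≡ l
    corners-order-l o₁ o₂ x y x₁ x₂ y₁ y₂ = by-cases (order ∩∪ ≤? l)
      where
      total : order ∩∪ + order ∪∩ ≤ l + l
      total = ≤-trans corners-submodular (≤-reflexive (cong₂ _+_ o₁ o₂))
      ∪∩≥l : order ∪∩ ≤ l → l ≤ order ∪∩
      ∪∩≥l ∪∩≤l = distinguisher-order≥l ds-∪∩ (∪∩-towards-Q y y₁ y₂ ∪∩≤l) (∪∩-towards-P₁ x x₁ ∪∩≤l)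
      by-cases : Dec (order ∩∪ ≤ l) → order ∩∪ ≡ l × order ∪∩ ≡ l
      by-cases (yes ∩∪≤l) = ∩∪≡l , ≤-antisym ∪∩≤l (∪∩≥l ∪∩≤l)
        where
        ∩∪≡l : order ∩∪ ≡ l
        ∩∪≡l = ≤-antisym ∩∪≤l
          (distinguisher-order≥l ds-∩∪ (∩∪-towards-Q₁ y y₁ ∩∪≤l) (∩∪-towards-P x x₁ x₂ ∩∪≤l))
        ∪∩≤l : order ∪∩ ≤ l
        ∪∩≤l = +-cancelˡ-≤ l _ _ (≤-trans (≤-reflexive (cong (_+ order ∪∩) (sym ∩∪≡l))) total)
      by-cases (no ∩∪≰l) = ⊥-elim (<⇒≱ ∪∩<l (∪∩≥l (<⇒≤ ∪∩<l)))
        where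
        ∪∩<l : order ∪∩ < l
        ∪∩<l = +-cancelˡ-< l _ _ (<-≤-trans (+-monoˡ-< (order ∪∩) (≰⇒> ∩∪≰l)) total)

  Forwardₗ : Subset (Digraph.n Gr) → Subset (Digraph.n Gr) → Set
  Forwardₗ P Q = Forward P Q × ∣ P ∩ Q ∣ ≡ l

  Splits : Pair Gr → Pair Gr → BoolSet N → Set
  Splits s t S = (∀ x → S x ≡ true → 𝒯 x s) × (∀ x → S x ≡ false → 𝒯 x t)

  -- 𝓧 S: S is the set of tangles on the P-side of an order-l separation from P to Q;
  -- 𝓨 S: S is the set of tangles on its Q-side.
  𝓧 𝓨 : BoolSet N → Set
  𝓧 S = Σ _ λ P → Σ _ λ Q → Forwardₗ P Q × Splits (swap (bare P Q)) (bare P Q) S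
  𝓨 S = Σ _ λ P → Σ _ λ Q → Forwardₗ P Q × Splits (bare P Q) (swap (bare P Q)) S

  Splits-resp : ∀ {s t S T} → S ≗ T → Splits s t S → Splits s t T
  Splits-resp S≗T (in-S , out-S) = (λ x → in-S x ∘ trans (S≗T x)) , (λ x → out-S x ∘ trans (S≗T x))

  𝓧-resp : ∀ {S T} → S ≗ T → 𝓧 S → 𝓧 T
  𝓧-resp S≗T (P , Q , f , splits) = P , Q , f , Splits-resp S≗T splits

  𝓨-resp : ∀ {S T} → S ≗ T → 𝓨 S → 𝓨 T
  𝓨-resp S≗T (P , Q , f , splits) = P , Q , f , Splits-resp S≗T splits

  𝓧-uncross : ∀ r A B → 𝓧 A → 𝓧 B → A r ≡ false → B r ≡ false →
    Meets A B → 𝓧 (A ∩ᵇ B) × 𝓧 (A ∪ᵇ B)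
  𝓧-uncross r A B (P₁ , Q₁ , (f₁ , o₁) , in₁ , out₁) (P₂ , Q₂ , (f₂ , o₂) , in₂ , out₂) Ar Br (x , Ax , Bx) =
    (P₁ ∩ P₂ , Q₁ ∪ Q₂ , (Forward-∩∪ , proj₁ orders) , splits-∩) ,
    (P₁ ∪ P₂ , Q₁ ∩ Q₂ , (Forward-∪∩ , proj₂ orders) , splits-∪)
    where
    open CornerOrientations f₁ f₂
    orders : order ∩∪ ≡ l × order ∪∩ ≡ l
    orders = corners-order-l o₁ o₂ x r (in₁ x Ax) (in₂ x Bx) (out₁ r Ar) (out₂ r Br)
    splits-∩ : Splits (swap ∩∪) ∩∪ (A ∩ᵇ B)
    splits-∩ = (λ y h → ∩∪-towards-P y (in₁ y (∧≡true⇒ˡ h)) (in₂ y (∧≡true⇒ʳ h)) (≤-reflexive (proj₁ orders)))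
             , (λ y h → [ (λ Ay → ∩∪-towards-Q₁ y (out₁ y Ay) (≤-reflexive (proj₁ orders)))
                        , (λ By → ∩∪-towards-Q₂ y (out₂ y By) (≤-reflexive (proj₁ orders))) ]′ (∧≡false⁻ h))
    splits-∪ : Splits (swap ∪∩) ∪∩ (A ∪ᵇ B)
    splits-∪ = (λ y h → [ (λ Ay → ∪∩-towards-P₁ y (in₁ y Ay) (≤-reflexive (proj₂ orders)))
                        , (λ By → ∪∩-towards-P₂ y (in₂ y By) (≤-reflexive (proj₂ orders))) ]′ (∨≡true⁻ h))
             , (λ y h → let Ay , By = ∨≡false⁻ h in ∪∩-towards-Q y (out₁ y Ay) (out₂ y By) (≤-reflexive (proj₂ orders)))

  𝓨-uncross : ∀ r A B → 𝓨 A → 𝓨 B → A r ≡ false → B r ≡ false →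
    Meets A B → 𝓨 (A ∩ᵇ B) × 𝓨 (A ∪ᵇ B)
  𝓨-uncross r A B (P₁ , Q₁ , (f₁ , o₁) , in₁ , out₁) (P₂ , Q₂ , (f₂ , o₂) , in₂ , out₂) Ar Br (x , Ax , Bx) =
    (P₁ ∪ P₂ , Q₁ ∩ Q₂ , (Forward-∪∩ , proj₂ orders) , splits-∩) ,
    (P₁ ∩ P₂ , Q₁ ∪ Q₂ , (Forward-∩∪ , proj₁ orders) , splits-∪)
    where
    open CornerOrientations f₁ f₂
    orders : order ∩∪ ≡ l × order ∪∩ ≡ l
    orders = corners-order-l o₁ o₂ r x (out₁ r Ar) (out₂ r Br) (in₁ x Ax) (in₂ x Bx)
    splits-∩ : Splits ∪∩ (swap ∪∩) (A ∩ᵇ B)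
    splits-∩ = (λ y h → ∪∩-towards-Q y (in₁ y (∧≡true⇒ˡ h)) (in₂ y (∧≡true⇒ʳ h)) (≤-reflexive (proj₂ orders)))
             , (λ y h → [ (λ Ay → ∪∩-towards-P₁ y (out₁ y Ay) (≤-reflexive (proj₂ orders)))
                        , (λ By → ∪∩-towards-P₂ y (out₂ y By) (≤-reflexive (proj₂ orders))) ]′ (∧≡false⁻ h))
    splits-∪ : Splits ∩∪ (swap ∩∪) (A ∪ᵇ B)
    splits-∪ = (λ y h → [ (λ Ay → ∩∪-towards-Q₁ y (in₁ y Ay) (≤-reflexive (proj₁ orders)))
                        , (λ By → ∩∪-towards-Q₂ y (in₂ y By) (≤-reflexive (proj₁ orders))) ]′ (∨≡true⁻ h))
             , (λ y h → let Ay , By = ∨≡false⁻ h in ∩∪-towards-P y (out₁ y Ay) (out₂ y By) (≤-reflexive (proj₁ orders)))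

  𝓧𝓨-uncross : ∀ A B → 𝓧 A → 𝓨 B → A ⊈ᵇ B →
    B ⊈ᵇ A → 𝓧 (A ∖ᵇ B) × 𝓨 (B ∖ᵇ A)
  𝓧𝓨-uncross A B (P₁ , Q₁ , (f₁ , o₁) , in₁ , out₁) (P₂ , Q₂ , (f₂ , o₂) , in₂ , out₂) (x , Ax , Bx) (y , By , Ay) =
    (P₁ ∩ P₂ , Q₁ ∪ Q₂ , (Forward-∩∪ , proj₁ orders) , splits-A∖B) ,
    (P₁ ∪ P₂ , Q₁ ∩ Q₂ , (Forward-∪∩ , proj₂ orders) , splits-B∖A)
    where
    open CornerOrientations f₁ f₂
    orders : order ∩∪ ≡ l × order ∪∩ ≡ l
    orders = corners-order-l o₁ o₂ x y (in₁ x Ax) (out₂ x Bx) (out₁ y Ay) (in₂ y By)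
    splits-A∖B : Splits (swap ∩∪) ∩∪ (A ∖ᵇ B)
    splits-A∖B = (λ z h → ∩∪-towards-P z (in₁ z (∧≡true⇒ˡ h)) (out₂ z (not≡true⇒ (∧≡true⇒ʳ h))) (≤-reflexive (proj₁ orders)))
               , (λ z h → [ (λ Az → ∩∪-towards-Q₁ z (out₁ z Az) (≤-reflexive (proj₁ orders)))
                          , (λ ¬Bz → ∩∪-towards-Q₂ z (in₂ z (not≡false⇒ ¬Bz)) (≤-reflexive (proj₁ orders))) ]′ (∧≡false⁻ h))
    splits-B∖A : Splits ∪∩ (swap ∪∩) (B ∖ᵇ A)
    splits-B∖A = (λ z h → ∪∩-towards-Q z (out₁ z (not≡true⇒ (∧≡true⇒ʳ h))) (in₂ z (∧≡true⇒ˡ h)) (≤-reflexive (proj₂ orders)))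
               , (λ z h → [ (λ Bz → ∪∩-towards-P₂ z (out₂ z Bz) (≤-reflexive (proj₂ orders)))
                          , (λ ¬Az → ∪∩-towards-P₁ z (in₁ z (not≡false⇒ ¬Az)) (≤-reflexive (proj₂ orders))) ]′ (∧≡false⁻ h))

  Forwardₗ⇒IsDirSep : ∀ {P Q} → Forwardₗ P Q → IsDirSep Gr (bare P Q)
  Forwardₗ⇒IsDirSep = Forward⇒IsDirSep ∘ proj₁

  Forwardₗ⇒IsDirSep⁻¹ : ∀ {P Q} → Forwardₗ P Q → IsDirSep Gr (swap (bare P Q))
  Forwardₗ⇒IsDirSep⁻¹ = IsDirSep-swap ∘ Forwardₗ⇒IsDirSep

  Forwardₗ⇒order≤l : ∀ {P Q} → Forwardₗ P Q → order (bare P Q) ≤ l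
  Forwardₗ⇒order≤l = ≤-reflexive ∘ proj₂

  Forwardₗ⇒order⁻¹≤l : ∀ {P Q} → Forwardₗ P Q → order (swap (bare P Q)) ≤ l
  Forwardₗ⇒order⁻¹≤l {P} {Q} f = ≤-trans (≤-reflexive (order-swap (bare P Q))) (Forwardₗ⇒order≤l f)

  Forwardₗ? : ∀ P Q → Dec (Forwardₗ P Q)
  Forwardₗ? P Q = ((≡-dec 𝔹._≟_ (P ∪ Q) ⊤) ×-dec no-edge?) ×-dec (∣ P ∩ Q ∣ ≟ℕ l)
    where
    open Digraph Gr using (tail; head)
    no-edge? : Dec (NoEdgeFromTo Gr (subgraph P ∅) (subgraph Q ∅))
    no-edge? = all? λ e →
      ¬? ((tail e ∈? P) ×-dec ¬? (tail e ∈? Q) ×-dec (head e ∈? Q) ×-dec ¬? (head e ∈? P))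

  Splits? : ∀ s t S → IsDirSep Gr s → order s ≤ l → IsDirSep Gr t → order t ≤ l → Dec (Splits s t S)
  Splits? s t S ds os dt ot =
    map′ (λ f → proj₁ ∘ f , proj₂ ∘ f) (λ (in-S , out-S) x → in-S x , out-S x)
      (all? λ x → by-membership (S x) (𝒯ᵢ.T? x s ds os) (𝒯ᵢ.T? x t dt ot))
    where
    by-membership : ∀ {X Y : Set} b → Dec X → Dec Y → Dec ((b ≡ true → X) × (b ≡ false → Y))
    by-membership true (yes x) _ = yes ((λ _ → x) , λ ())
    by-membership true (no ¬x) _ = no λ (f , _) → ¬x (f refl)
    by-membership false _ (yes y) = yes ((λ ()) , λ _ → y)
    by-membership false _ (no ¬y) = no λ (_ , g) → ¬y (g refl)

  𝓧? : ∀ S → Dec (𝓧 S)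
  𝓧? S = anySubset? λ P → anySubset? λ Q → ×-dec-given (Forwardₗ? P Q) λ f →
    Splits? _ _ S (Forwardₗ⇒IsDirSep⁻¹ f) (Forwardₗ⇒order⁻¹≤l f) (Forwardₗ⇒IsDirSep f) (Forwardₗ⇒order≤l f)

  𝓨? : ∀ S → Dec (𝓨 S)
  𝓨? S = anySubset? λ P → anySubset? λ Q → ×-dec-given (Forwardₗ? P Q) λ f →
    Splits? _ _ S (Forwardₗ⇒IsDirSep f) (Forwardₗ⇒order≤l f) (Forwardₗ⇒IsDirSep⁻¹ f) (Forwardₗ⇒order⁻¹≤l f)

  module _ {P Q} (f : Forwardₗ P Q) where

    P-side? : ∀ x → Dec (𝒯 x (swap (bare P Q)))
    P-side? x = 𝒯ᵢ.T? x (swap (bare P Q)) (Forwardₗ⇒IsDirSep⁻¹ f) (Forwardₗ⇒order⁻¹≤l f)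

    P-side : BoolSet N
    P-side x = does (P-side? x)

    P-side-splits : Splits (swap (bare P Q)) (bare P Q) P-side
    P-side-splits = (λ x → does≡true⇒ (P-side? x))
                  , (λ x h → [ id , (λ t → ⊥-elim (does≡false⇒ (P-side? x) h t)) ]′
                               (𝒯ᵢ.orient x (bare P Q) (Forwardₗ⇒IsDirSep f) (Forwardₗ⇒order≤l f)))

    P-side-𝓧 : 𝓧 P-side
    P-side-𝓧 = P , Q , f , P-side-splits

    Q-side-𝓨 : 𝓨 (not ∘ P-side)
    Q-side-𝓨 = P , Q , f , (λ x → proj₂ P-side-splits x ∘ not≡true⇒) , (λ x → proj₁ P-side-splits x ∘ not≡false⇒)

    P-side-separates : ∀ {x y} → Distinguishes (𝒯 x) (𝒯 y) (bare P Q) → P-side x ≢ P-side y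
    P-side-separates {x} {y} = [ (λ (tx , ty) eq → at-Q x tx (trans eq (at-P y ty)))
                               , (λ (tx , ty) eq → at-Q y ty (trans (sym eq) (at-P x tx))) ]′
      where
      at-P : ∀ z → 𝒯 z (swap (bare P Q)) → P-side z ≡ true
      at-P z t = ≢false⇒≡true λ h → 𝒯ᵢ.not-both z (Forwardₗ⇒IsDirSep f) (proj₂ P-side-splits z h) t
      at-Q : ∀ z → 𝒯 z (bare P Q) → P-side z ≢ true
      at-Q z t h = 𝒯ᵢ.not-both z (Forwardₗ⇒IsDirSep f) t (proj₁ P-side-splits z h)

  Distinguishes-bare : ∀ {x y A B} → IsDirSep Gr (A , B) → order (A , B) ≡ l → Distinguishes (𝒯 x) (𝒯 y) (A , B) →
    Distinguishes (𝒯 x) (𝒯 y) (bare (V A) (V B))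
  Distinguishes-bare {x} {y} {A} {B} ds@(_ , _ , cover , no-edge) o =
    [ (λ (tx , ty) → inj₁ (to-bare x tx , to-bare⁻¹ y ty)) , (λ (tx , ty) → inj₂ (to-bare⁻¹ x tx , to-bare y ty)) ]′
    where
    ds₀ : IsDirSep Gr (bare (V A) (V B))
    ds₀ = (λ _ e∈∅ → ⊥-elim (∉⊥ e∈∅)) , (λ _ e∈∅ → ⊥-elim (∉⊥ e∈∅)) , cover , no-edge
    to-bare : ∀ z → 𝒯 z (A , B) → 𝒯 z (bare (V A) (V B))
    to-bare z = 𝒯ᵢ.T-mono z ds ds₀ (≤-reflexive o) ((λ _ → id) , (λ _ → id))
    to-bare⁻¹ : ∀ z → 𝒯 z (B , A) → 𝒯 z (swap (bare (V A) (V B)))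
    to-bare⁻¹ z = 𝒯ᵢ.T-mono z (IsDirSep-swap ds) (IsDirSep-swap ds₀)
      (≤-trans (≤-reflexive (order-swap (bare (V A) (V B)))) (≤-reflexive o)) ((λ _ → id) , (λ _ → id))

  bare-distinguisher : ∀ {x y s} → IsDirSep Gr s → order s ≡ l → Distinguishes (𝒯 x) (𝒯 y) s →
    Σ _ λ P → Σ _ λ Q → Forwardₗ P Q × Distinguishes (𝒯 x) (𝒯 y) (bare P Q)
  bare-distinguisher {x} {y} {A , B} ds@(_ , _ , cover , no-edge) o dist with no-edge
  ... | inj₁ A↛B = V A , V B , ((cover , A↛B) , o) , Distinguishes-bare ds o dist
  ... | inj₂ B↛A = V B , V A , ((proj₁ (proj₂ (proj₂ (IsDirSep-swap ds))) , B↛A) , trans (order-swap (A , B)) o) ,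
                   Data.Sum.swap (Distinguishes-bare ds o dist)

  separating-side-set : ∀ r x y → x ≢ y → Σ (BoolSet N) λ S → (𝓧 S ⊎ 𝓨 S) × S r ≡ false × S x ≢ S y
  separating-side-set r x y x≢y with proj₁ (distinguishability x y x≢y)
  ... | s , ds , o , dist with bare-distinguisher ds o dist
  ...   | P , Q , f , dist₀ with true-or-false (P-side f r)
  ...     | inj₂ r-Q = P-side f , inj₁ (P-side-𝓧 f) , r-Q , P-side-separates f dist₀
  ...     | inj₁ r-P = not ∘ P-side f , inj₂ (Q-side-𝓨 f) , cong not r-P , P-side-separates f dist₀ ∘ 𝔹.not-injective

-- The tree-labelling

module TreeLabelling (Gr : Digraph) (l n : ℕ) (𝒯 : Fin (suc n) → SepSet Gr)
  (tangles : ∀ i → ∃[ k ] (l < k × IsTangle Gr k (𝒯 i)))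
  (distinguishability : ∀ i j → i ≢ j → Distinguishable Gr l (𝒯 i) (𝒯 j) ×
     (∀ j′ → suc j′ ≡ l → ¬ Distinguishable Gr j′ (𝒯 i) (𝒯 j))) where

  open Separations Gr
  open Tangles Gr l (suc n) 𝒯 tangles distinguishability
  open Laminar zero 𝓧 𝓨 𝓧-resp 𝓨-resp 𝓧? 𝓨? (𝓧-uncross zero) (𝓨-uncross zero) 𝓧𝓨-uncross

  avoids-root⇒⊆nonRoot : ∀ {S : BoolSet (suc n)} → S zero ≡ false → S ⊆ᵇ nonRoot
  avoids-root⇒⊆nonRoot S0 zero S0′ = ⊥-elim (≡true⇒≢false S0′ S0)
  avoids-root⇒⊆nonRoot _ (suc _) _ = refl

  nonRoot-covered : Covered nonRoot
  nonRoot-covered (suc i) _ =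
    let S , 𝓢S , S0 , Si≢S0 = separating-side-set zero (suc i) zero λ ()
    in S , 𝓢S , avoids-root⇒⊆nonRoot S0 , ≢∧false⇒true (Si≢S0 ∘ sym) S0

  nonRoot-separated : Separated nonRoot
  nonRoot-separated x y _ _ x≢y =
    let S , 𝓢S , S0 , Sx≢Sy = separating-side-set zero x y x≢y
    in S , 𝓢S , avoids-root⇒⊆nonRoot S0 , Sx≢Sy

  open NestedFamily (nestedFamily nonRoot refl nonRoot-covered nonRoot-separated)
  module Tree = TreeOfNestedSets n D D-refl D⊆G D-nested D-comparable D-antisym
  open Tree

  Label : Fin n → Set
  Label i = Σ (Pair Gr) λ γ → IsDirSep Gr γ × order γ ≡ l × Splits (swap γ) γ (below i)

  𝓢⇒Label : ∀ i → 𝓢 (below i) → Label i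
  𝓢⇒Label i (inj₁ (P , Q , f , splits)) = bare P Q , Forwardₗ⇒IsDirSep f , proj₂ f , splits
  𝓢⇒Label i (inj₂ (P , Q , f , splits)) =
    swap (bare P Q) , Forwardₗ⇒IsDirSep⁻¹ f , trans (order-swap (bare P Q)) (proj₂ f) , splits

  label : ∀ i → Label i
  label i = 𝓢⇒Label i (D-𝓢 (suc i) refl)

  γ : Fin n → Pair Gr
  γ i = proj₁ (label i)

  γ-order : ∀ i → order (γ i) ≡ l
  γ-order i = proj₁ (proj₂ (proj₂ (label i)))

  γ-minimum : ∀ i {t t′} → below i t ≢ below i t′ → MinDistinguisher Gr (𝒯 t) (𝒯 t′) (γ i)
  γ-minimum i {t} {t′} t≁t′ = ds , distinguishes (true-or-false (below i t)) , minimal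
    where
    ds : IsDirSep Gr (γ i)
    ds = proj₁ (proj₂ (label i))
    splits : Splits (swap (γ i)) (γ i) (below i)
    splits = proj₂ (proj₂ (proj₂ (label i)))
    distinguishes : below i t ≡ true ⊎ below i t ≡ false → Distinguishes (𝒯 t) (𝒯 t′) (γ i)
    distinguishes (inj₁ t-in) = inj₂ (proj₁ splits t t-in , proj₂ splits t′ (≢∧true⇒false t≁t′ t-in))
    distinguishes (inj₂ t-out) = inj₁ (proj₂ splits t t-out , proj₁ splits t′ (≢∧false⇒true t≁t′ t-out))
    minimal : ∀ s → IsDirSep Gr s → Distinguishes (𝒯 t) (𝒯 t′) s → order (γ i) ≤ order s
    minimal s ds′ dist = ≤-trans (≤-reflexive (γ-order i))
      ([ (λ (a , b) → distinguisher-order≥l ds′ a b) , (λ (a , b) → distinguisher-order≥l ds′ b a) ]′ dist)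

  isTreeLabelling : IsTreeLabelling Gr (suc n) 𝒯 tree id γ
  isTreeLabelling =
    tree-isTree ,
    (λ i → proj₁ (proj₂ (label i))) ,
    (id , (λ t → t , id)) ,
    (λ t t′ _ es path i i∈es _ → γ-minimum i (path-crossing-separates path i∈es)) ,
    (λ i → suc i , parent i , InComponentMinus-refl i (suc i) , InComponentMinus-refl i (parent i) ,
           γ-minimum i (below-on i (inj₁ refl)))

emptyGraph : Graph
emptyGraph = record { p = 0 ; q = 0 ; ends = λ () }

emptyTreeLabelling : ∀ G (𝒯 : Fin 0 → SepSet G) → IsTreeLabelling G 0 𝒯 emptyGraph (λ ()) (λ ())
emptyTreeLabelling G 𝒯 =
  (((λ ()) , (λ ())) , (λ ()) , λ { (() , _) }) , (λ ()) , ((λ { {()} }) , (λ ())) , (λ ()) , (λ ())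

theorem6p3 : (G : Digraph) (l : ℕ) (N : ℕ) (𝒯 : Fin N → SepSet G) →
    (∀ i → ∃[ k ] (l < k × IsTangle G k (𝒯 i))) →
    (∀ i j → i ≢ j →
      Distinguishable G l (𝒯 i) (𝒯 j) ×
      (∀ j′ → suc j′ ≡ l → ¬ Distinguishable G j′ (𝒯 i) (𝒯 j))) →
    ∃[ L ] Σ (Fin (Graph.p L) → Fin N) λ β → Σ (Fin (Graph.q L) → Pair G) λ γ →
      IsTreeLabelling G N 𝒯 L β γ × (∀ e → order {G} (γ e) ≡ l)
theorem6p3 G l zero 𝒯 _ _ = emptyGraph , (λ ()) , (λ ()) , emptyTreeLabelling G 𝒯 , λ ()
theorem6p3 G l (suc n) 𝒯 tangles distinguishability = Tree.tree , id , γ , isTreeLabelling , γ-order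
  where open TreeLabelling G l n 𝒯 tangles distinguishability
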